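{- Let $P(n,1)$ be the number of partitions of $n$ having exactly one missing integer (with $P(0,1)=0$). Then, for $|q|<1$, \[ \sum_{n=0}^{\infty}P(n,1)q^n=(-q;q)_{\infty}\sum_{k=1}^{\infty}\frac{q^{2k}}{1+q^k}. \] Moreover, for every $n\ge 0$, $P(n,1)$ equals the number of partitions of $n$ in which exactly one part occurs exactly twice and all other parts occur exactly once.
   Context: For a partition $\pi$ with largest part $L$, a missing integer of $\pi$ is a positive integer less than $L$ that does not occur as a part of $\pi$. Notation: $(a;q)_\infty=\prod_{i\ge1}(1-aq^{i-1})$. -}

module Defs where

open import Data.Bool using (Bool; true; false; if_then_else_; _∧_; not)
open import Data.Nat as ℕ using (ℕ; zero; suc; _∸_; _⊔_; _≡ᵇ_; _≤ᵇ_)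
open import Data.Integer as ℤ using (ℤ; +_; -_)
open import Data.List using (List; []; _∷_; map; concatMap; upTo; length; filterᵇ; foldr)

-- Partitions: a partition of n is a non-increasing list of positive
-- integers summing to n.  `partitionsBounded fuel n m` enumerates all
-- non-increasing lists of positive parts, each ≤ m, summing to n
-- (fuel ≥ n suffices since each step removes a part ≥ 1).

partitionsBounded : ℕ → ℕ → ℕ → List (List ℕ)
partitionsBounded _        zero    _ = [] ∷ []
partitionsBounded zero     (suc _) _ = []
partitionsBounded (suc f)  (suc n) m =
  concatMap (λ p → map (p ∷_) (partitionsBounded f (suc n ∸ p) p))
            (map suc (upTo (m ℕ.⊓ suc n)))

partitions : ℕ → List (List ℕ)
partitions n = partitionsBounded n n n

largest : List ℕ → ℕ
largest = foldr _⊔_ 0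

elemᵇ : ℕ → List ℕ → Bool
elemᵇ x []       = false
elemᵇ x (y ∷ ys) = if x ≡ᵇ y then true else elemᵇ x ys

missing : List ℕ → List ℕ
missing π = filterᵇ (λ i → not (elemᵇ i π)) (map suc (upTo (largest π ∸ 1)))

P1 : ℕ → ℕ
P1 n = length (filterᵇ (λ π → length (missing π) ≡ᵇ 1) (partitions n))

mult : List ℕ → ℕ → ℕ
mult π v = length (filterᵇ (v ≡ᵇ_) π)

allᵇ : (ℕ → Bool) → List ℕ → Bool
allᵇ p []       = true
allᵇ p (x ∷ xs) = p x ∧ allᵇ p xs

oneDoubleRestDistinct : List ℕ → Bool
oneDoubleRestDistinct π =
  (length (filterᵇ (λ v → mult π v ≡ᵇ 2) (map suc (upTo (largest π)))) ≡ᵇ 1)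
  ∧ allᵇ (λ v → mult π v ≤ᵇ 2) π

Q : ℕ → ℕ
Q n = length (filterᵇ oneDoubleRestDistinct (partitions n))

Series : Set
Series = ℕ → ℤ

sumℤ : List ℤ → ℤ
sumℤ = foldr ℤ._+_ (+ 0)

_⊛_ : Series → Series → Series
(f ⊛ g) n = sumℤ (map (λ i → f i ℤ.* g (n ∸ i)) (upTo (suc n)))

one : Series
one m = if m ≡ᵇ 0 then + 1 else + 0

qpow : ℕ → Series
qpow a m = if m ≡ᵇ a then + 1 else + 0

_⊕_ : Series → Series → Series
(f ⊕ g) n = f n ℤ.+ g n

-- (-q;q)_∞ = ∏_{i ≥ 1} (1 + q^i).  Its q^n coefficient is that of the
-- finite product ∏_{i=1}^{n} (1 + q^i) (factors with i > n are 1 mod q^{n+1}).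
finProd : ℕ → Series
finProd N = foldr (λ i s → (one ⊕ qpow i) ⊛ s) one (map suc (upTo N))

negQPoch : Series
negQPoch n = finProd n n

-- 1/(1+q^k) = Σ_{j ≥ 0} (-1)^j q^{kj}  (geometric series, k ≥ 1);
-- only j ≤ m can contribute to the q^m coefficient.
sign : ℕ → ℤ
sign zero    = + 1
sign (suc j) = - sign j

invOnePlus : ℕ → Series
invOnePlus k m = sumℤ (map (λ j → if (k ℕ.* j) ≡ᵇ m then sign j else + 0) (upTo (suc m)))

-- Σ_{k ≥ 1} q^{2k}/(1+q^k); terms with k > n do not contribute to q^n.
lambertSum : Series
lambertSum n = sumℤ (map (λ k → (qpow (2 ℕ.* k) ⊛ invOnePlus k) n) (map suc (upTo n)))

rhs : Series
rhs = negQPoch ⊛ lambertSum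

-- A partition with largest part k, read column by column (its conjugate), has k parts, and an integer
-- i < k is missing exactly when columns i and i + 1 have the same length.  So partitions with largest
-- part k and no missing integer, resp. exactly one, correspond to partitions into k distinct parts,
-- resp. into k parts among which exactly one value is repeated, exactly twice.  Instead of building
-- this bijection we show that both sides obey the same recursion in n: remove the largest part on the
-- one side, subtract 1 from every part on the other.  Summing over k gives P(n,1) = Q(n).
-- For the generating function, ∏_{i ≤ b} (1 + q^i) counts partitions into distinct parts ≤ b.  Its factor
-- 1 + q^k cancels the denominator of the k-th Lambert term q^{2k}/(1 + q^k), so their product counts the
-- partitions with parts ≤ b in which k occurs exactly twice and every other part once; summing over
-- k ≤ b, by induction on b, gives the generating function of Q.

module Submission where

open import Defs
open import Data.Nat using (ℕ)
open import Data.Product using (_×_; _,_)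
open import Relation.Binary.PropositionalEquality using (_≡_; trans; sym; cong)

module Shift {A : Set} (0# : A) where

  open import Data.Bool using (if_then_else_; true; false)
  open import Data.Nat using (ℕ; _+_; _∸_; _≤ᵇ_; _≤_; _<_; _≤?_)
  open import Data.Nat.Properties
  open import Relation.Binary.PropositionalEquality
  open import Relation.Nullary using (yes; no)
  open import Relation.Nullary.Decidable using (dec-true; dec-false)

  -- the series q^a · F
  shift : ℕ → (ℕ → A) → ℕ → A
  shift a F n = if a ≤ᵇ n then F (n ∸ a) else 0#

  shift-≤ : ∀ {a n} F → a ≤ n → shift a F n ≡ F (n ∸ a)
  shift-≤ {a} {n} F a≤n rewrite dec-true (a ≤? n) a≤n = refl

  shift-> : ∀ {a n} F → n < a → shift a F n ≡ 0#
  shift-> {a} {n} F n<a rewrite dec-false (a ≤? n) (<⇒≱ n<a) = refl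

  shift-cong : ∀ a n {F G : ℕ → A} → (∀ m → m + a ≡ n → F m ≡ G m) → shift a F n ≡ shift a G n
  shift-cong a n {F} {G} F≗G with a ≤? n
  ... | yes a≤n = trans (shift-≤ F a≤n) (trans (F≗G (n ∸ a) (m∸n+n≡m a≤n)) (sym (shift-≤ G a≤n)))
  ... | no a≰n = trans (shift-> F (≰⇒> a≰n)) (sym (shift-> G (≰⇒> a≰n)))

  shift-const : ∀ a n → shift a (λ _ → 0#) n ≡ 0#
  shift-const a n with a ≤ᵇ n
  ... | true = refl
  ... | false = refl

  shift-distrib : ∀ (_∙_ : A → A → A) → 0# ∙ 0# ≡ 0# →
                  ∀ a n F G → shift a (λ m → F m ∙ G m) n ≡ shift a F n ∙ shift a G n
  shift-distrib _∙_ 0∙0 a n F G with a ≤ᵇ n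
  ... | true = refl
  ... | false = sym 0∙0

  shift-shift : ∀ a c n F → shift a (shift c F) n ≡ shift (a + c) F n
  shift-shift a c n F with a ≤? n
  ... | no a≰n = trans (shift-> (shift c F) (≰⇒> a≰n)) (sym (shift-> F (<-≤-trans (≰⇒> a≰n) (m≤m+n a c))))
  ... | yes a≤n with c ≤? n ∸ a
  ...   | yes c≤n∸a = begin
          shift a (shift c F) n ≡⟨ shift-≤ (shift c F) a≤n ⟩
          shift c F (n ∸ a)     ≡⟨ shift-≤ F c≤n∸a ⟩
          F (n ∸ a ∸ c)         ≡⟨ cong F (∸-+-assoc n a c) ⟩
          F (n ∸ (a + c))       ≡⟨ shift-≤ F (subst (a + c ≤_) (m+[n∸m]≡n a≤n) (+-monoʳ-≤ a c≤n∸a)) ⟨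
          shift (a + c) F n     ∎
    where open ≡-Reasoning
  ...   | no c≰n∸a = trans (shift-≤ (shift c F) a≤n) (trans (shift-> F (≰⇒> c≰n∸a))
            (sym (shift-> F (subst (_< a + c) (m+[n∸m]≡n a≤n) (+-monoʳ-< a (≰⇒> c≰n∸a))))))

module Partitions where

  open import Data.Bool using (Bool; true; false; if_then_else_; _∧_; not; T)
  open import Data.Bool.Properties using (∧-comm; ∧-zeroʳ)
  open import Data.Nat using (ℕ; zero; suc; _+_; _∸_; _⊓_; _≡ᵇ_; _≤ᵇ_; _≤_; _<_; z≤n; s≤s; _≤?_; _≟_)
  open import Data.Nat.Properties
  open import Data.Nat.Induction using (<-rec)
  open import Data.List using (List; []; _∷_; map; concatMap; upTo; length; filterᵇ; _++_; [_])
  open import Data.List.Properties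
    using (length-++; filter-++; upTo-∷ʳ; map-++; concatMap-map; concatMap-cong; concatMap-++; ++-identityʳ)
  open import Data.List.Relation.Unary.All as All using (All; []; _∷_)
  open import Data.List.Relation.Unary.All.Properties using (map⁺; concat⁺; applyUpTo⁺₁)
  open import Function using (_∘_)
  open import Data.Nat.Tactic.RingSolver using (solve-∀)
  open import Algebra.Properties.CommutativeSemigroup +-commutativeSemigroup using (interchange)
  open import Relation.Binary.PropositionalEquality hiding ([_])
  open import Relation.Nullary using (yes; no)
  open import Relation.Nullary.Decidable using (T?; dec-true; dec-false)
  open import Data.Sum using (_⊎_; inj₁; inj₂)
  open import Data.Product using (_×_; _,_; proj₁; proj₂)
  open import Data.Empty using (⊥-elim)

  open Shift 0

  shift-+ : ∀ a n F G → shift a (λ m → F m + G m) n ≡ shift a F n + shift a G n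
  shift-+ = shift-distrib _+_ refl

  ≡ᵇ-refl : ∀ p → (p ≡ᵇ p) ≡ true
  ≡ᵇ-refl p = dec-true (p ≟ p) refl

  private variable A B : Set

  count : (A → Bool) → List A → ℕ
  count p xs = length (filterᵇ p xs)

  count-∷ : ∀ (p : A → Bool) x xs → count p (x ∷ xs) ≡ (if p x then 1 else 0) + count p xs
  count-∷ p x xs with p x
  ... | true = refl
  ... | false = refl

  count-++ : ∀ (p : A → Bool) xs ys → count p (xs ++ ys) ≡ count p xs + count p ys
  count-++ p xs ys = trans (cong length (filter-++ (T? ∘ p) xs ys)) (length-++ (filterᵇ p xs))

  count-map : ∀ (p : B → Bool) (f : A → B) xs → count p (map f xs) ≡ count (p ∘ f) xs
  count-map p f [] = refl
  count-map p f (x ∷ xs) =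
    trans (count-∷ p (f x) (map f xs)) (trans (cong (_ +_) (count-map p f xs)) (sym (count-∷ (p ∘ f) x xs)))

  count-cong : ∀ {Q : A → Set} {p p' : A → Bool} {xs} → All Q xs →
               (∀ {x} → Q x → p x ≡ p' x) → count p xs ≡ count p' xs
  count-cong {p = p} {p'} {x ∷ xs} (qx ∷ qxs) p≗p' =
    trans (count-∷ p x xs) (trans (cong₂ (λ b c → (if b then 1 else 0) + c) (p≗p' qx) (count-cong qxs p≗p'))
                                  (sym (count-∷ p' x xs)))
  count-cong [] _ = refl

  count-none : ∀ {Q : A → Set} {p : A → Bool} {xs} → All Q xs → (∀ {x} → Q x → p x ≡ false) → count p xs ≡ 0
  count-none {xs = xs} qs p≡false = trans (count-cong qs p≡false) (count-false xs)
    where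
    count-false : ∀ xs → count (λ _ → false) xs ≡ 0
    count-false [] = refl
    count-false (_ ∷ xs) = count-false xs

  sumBelow : ℕ → (ℕ → ℕ) → ℕ
  sumBelow zero f = 0
  sumBelow (suc k) f = sumBelow k f + f k

  sumBelow-cong : ∀ k {f g} → (∀ {v} → v < k → f v ≡ g v) → sumBelow k f ≡ sumBelow k g
  sumBelow-cong zero f≗g = refl
  sumBelow-cong (suc k) f≗g = cong₂ _+_ (sumBelow-cong k (f≗g ∘ m<n⇒m<1+n)) (f≗g ≤-refl)

  sumBelow-zero : ∀ k {f} → (∀ {v} → v < k → f v ≡ 0) → sumBelow k f ≡ 0
  sumBelow-zero k f≡0 = trans (sumBelow-cong k f≡0) (sumBelow-0 k)
    where
    sumBelow-0 : ∀ k → sumBelow k (λ _ → 0) ≡ 0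
    sumBelow-0 zero = refl
    sumBelow-0 (suc k) = cong (_+ 0) (sumBelow-0 k)

  sumBelow-+ : ∀ k f g → sumBelow k (λ v → f v + g v) ≡ sumBelow k f + sumBelow k g
  sumBelow-+ zero f g = refl
  sumBelow-+ (suc k) f g =
    trans (cong (_+ (f k + g k)) (sumBelow-+ k f g)) (interchange (sumBelow k f) (sumBelow k g) (f k) (g k))

  sumBelow-indicator : ∀ {k a} c → a < k →
                       sumBelow k (λ v → if c ∧ (a ≡ᵇ v) then 1 else 0) ≡ (if c then 1 else 0)
  sumBelow-indicator {k} false _ = sumBelow-zero k (λ _ → refl)
  sumBelow-indicator {suc k} {a} true a<1+k with a ≟ k
  ... | yes refl rewrite ≡ᵇ-refl a =
    cong (_+ 1) (sumBelow-zero a (λ v<a → cong (λ b → if b then 1 else 0) (dec-false (a ≟ _) (>⇒≢ v<a))))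
  ... | no a≢k rewrite dec-false (a ≟ k) a≢k =
    trans (+-identityʳ _) (sumBelow-indicator true (≤∧≢⇒< (≤-pred a<1+k) a≢k))

  count-split : ∀ (p : A → Bool) (g : A → ℕ) k {xs} → All (λ x → g x < k) xs →
                count p xs ≡ sumBelow k (λ v → count (λ x → p x ∧ (g x ≡ᵇ v)) xs)
  count-split p g k [] = sym (sumBelow-zero k (λ _ → refl))
  count-split p g k {x ∷ xs} (gx<k ∷ gxs<k) = begin
    count p (x ∷ xs)
      ≡⟨ count-∷ p x xs ⟩
    (if p x then 1 else 0) + count p xs
      ≡⟨ cong₂ _+_ (sumBelow-indicator (p x) gx<k) (sym (count-split p g k gxs<k)) ⟨
    sumBelow k (λ v → if p x ∧ (g x ≡ᵇ v) then 1 else 0) + sumBelow k (λ v → count (p-at v) xs)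
      ≡⟨ sumBelow-+ k _ _ ⟨
    sumBelow k (λ v → (if p x ∧ (g x ≡ᵇ v) then 1 else 0) + count (p-at v) xs)
      ≡⟨ sumBelow-cong k (λ {v} _ → count-∷ (p-at v) x xs) ⟨
    sumBelow k (λ v → count (p-at v) (x ∷ xs)) ∎
    where
    open ≡-Reasoning
    p-at : ℕ → _ → Bool
    p-at v x = p x ∧ (g x ≡ᵇ v)


  partitionsBounded-fuel : ∀ {f g} n b → n ≤ f → n ≤ g →
                           partitionsBounded f n b ≡ partitionsBounded g n b
  partitionsBounded-fuel zero b _ _ = refl
  partitionsBounded-fuel {suc f} {suc g} (suc n) b (s≤s n≤f) (s≤s n≤g) =
    trans (concatMap-map _ suc (upTo (b ⊓ suc n)))
          (trans (concatMap-cong branch (upTo (b ⊓ suc n))) (sym (concatMap-map _ suc (upTo (b ⊓ suc n)))))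
    where
    branch : ∀ x → map (suc x ∷_) (partitionsBounded f (n ∸ x) (suc x)) ≡
                   map (suc x ∷_) (partitionsBounded g (n ∸ x) (suc x))
    branch x = cong (map (suc x ∷_))
      (partitionsBounded-fuel (n ∸ x) (suc x) (≤-trans (m∸n≤m n x) n≤f) (≤-trans (m∸n≤m n x) n≤g))

  partitionsBounded-stable : ∀ f n b → n ≤ b → partitionsBounded f n b ≡ partitionsBounded f n n
  partitionsBounded-stable f zero b _ = refl
  partitionsBounded-stable zero (suc n) b _ = refl
  partitionsBounded-stable (suc f) (suc n) b n≤b =
    cong (λ c → concatMap (λ p → map (p ∷_) (partitionsBounded f (suc n ∸ p) p)) (map suc (upTo c)))
         (trans (m≥n⇒m⊓n≡n n≤b) (sym (⊓-idem (suc n))))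

  data BoundedPartition : ℕ → ℕ → List ℕ → Set where
    []   : ∀ {b} → BoundedPartition b 0 []
    cons : ∀ {b p s r} → 1 ≤ p → p ≤ b → BoundedPartition p s r → BoundedPartition b (p + s) (p ∷ r)

  partitionsBounded-sound : ∀ f n b → n ≤ f → All (BoundedPartition b n) (partitionsBounded f n b)
  partitionsBounded-sound f zero b _ = [] ∷ []
  partitionsBounded-sound (suc f) (suc n) b (s≤s n≤f) =
    subst (All (BoundedPartition b (suc n))) (sym (concatMap-map _ suc (upTo (b ⊓ suc n))))
      (concat⁺ (map⁺ (applyUpTo⁺₁ _ (b ⊓ suc n) (λ x<b⊓1+n → map⁺ (All.map (extend x<b⊓1+n) (recursive _))))))
    where
    recursive : ∀ x → All (BoundedPartition (suc x) (n ∸ x)) (partitionsBounded f (n ∸ x) (suc x))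
    recursive x = partitionsBounded-sound f (n ∸ x) (suc x) (≤-trans (m∸n≤m n x) n≤f)
    extend : ∀ {x r} → x < b ⊓ suc n → BoundedPartition (suc x) (n ∸ x) r → BoundedPartition b (suc n) (suc x ∷ r)
    extend {x} {r} x<b⊓1+n ρ =
      subst (λ s → BoundedPartition b s (suc x ∷ r)) (cong suc (m+[n∸m]≡n (≤-pred (≤-trans x<b⊓1+n (m⊓n≤n b (suc n))))))
            (cons (s≤s z≤n) (≤-trans x<b⊓1+n (m⊓n≤m b (suc n))) ρ)

  countPartitions : (List ℕ → Bool) → ℕ → ℕ → ℕ
  countPartitions P n b = count P (partitionsBounded n n b)

  countPartitions-cong : ∀ P P' n b → (∀ {π} → BoundedPartition b n π → P π ≡ P' π) →
                         countPartitions P n b ≡ countPartitions P' n b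
  countPartitions-cong P P' n b = count-cong (partitionsBounded-sound n n b ≤-refl)

  countPartitions-none : ∀ P n b → (∀ {π} → BoundedPartition b n π → P π ≡ false) → countPartitions P n b ≡ 0
  countPartitions-none P n b = count-none (partitionsBounded-sound n n b ≤-refl)

  countPartitions-stable : ∀ P {n b} → n ≤ b → countPartitions P n b ≡ countPartitions P n n
  countPartitions-stable P {n} {b} n≤b = cong (count P) (partitionsBounded-stable n n b n≤b)

  countStartingWith : (List ℕ → Bool) → ℕ → ℕ → ℕ
  countStartingWith P p = shift p (λ m → countPartitions (P ∘ (p ∷_)) m p)

  countStartingWith-cong : ∀ P P' p n → (∀ {s r} → BoundedPartition p s r → P (p ∷ r) ≡ P' (p ∷ r)) →
                           countStartingWith P p n ≡ countStartingWith P' p n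
  countStartingWith-cong P P' p n P≗P' =
    shift-cong p n (λ m _ → countPartitions-cong (P ∘ (p ∷_)) (P' ∘ (p ∷_)) m p P≗P')

  countStartingWith-none : ∀ P p n → (∀ {s r} → BoundedPartition p s r → P (p ∷ r) ≡ false) →
                           countStartingWith P p n ≡ 0
  countStartingWith-none P p n P≡false =
    trans (shift-cong p n (λ m _ → countPartitions-none (P ∘ (p ∷_)) m p P≡false))
          (shift-const p n)

  countPartitions-suc : ∀ P n b → countPartitions P n (suc b) ≡ countPartitions P n b + countStartingWith P (suc b) n
  countPartitions-suc P zero b = sym (+-identityʳ _)
  countPartitions-suc P (suc n) b with b ≤? n
  ... | yes b≤n = begin
    count P (concatMap branch (map suc (upTo (suc b ⊓ suc n))))
      ≡⟨ cong (λ c → count P (concatMap branch (map suc (upTo c)))) (m≤n⇒m⊓n≡m (s≤s b≤n)) ⟩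
    count P (concatMap branch (map suc (upTo (suc b))))
      ≡⟨ cong (λ xs → count P (concatMap branch (map suc xs))) (upTo-∷ʳ b) ⟨
    count P (concatMap branch (map suc (upTo b ++ [ b ])))
      ≡⟨ cong (λ xs → count P (concatMap branch xs)) (map-++ suc (upTo b) [ b ]) ⟩
    count P (concatMap branch (map suc (upTo b) ++ [ suc b ]))
      ≡⟨ cong (count P) (concatMap-++ branch (map suc (upTo b)) [ suc b ]) ⟩
    count P (concatMap branch (map suc (upTo b)) ++ (branch (suc b) ++ []))
      ≡⟨ count-++ P (concatMap branch (map suc (upTo b))) (branch (suc b) ++ []) ⟩
    count P (concatMap branch (map suc (upTo b))) + count P (branch (suc b) ++ [])
      ≡⟨ cong₂ _+_ lower top ⟩
    countPartitions P (suc n) b + countStartingWith P (suc b) (suc n) ∎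
    where
    open ≡-Reasoning
    branch : ℕ → List (List ℕ)
    branch p = map (p ∷_) (partitionsBounded n (suc n ∸ p) p)
    lower : count P (concatMap branch (map suc (upTo b))) ≡ countPartitions P (suc n) b
    lower = cong (λ c → count P (concatMap branch (map suc (upTo c)))) (sym (m≤n⇒m⊓n≡m (m≤n⇒m≤1+n b≤n)))
    top : count P (branch (suc b) ++ []) ≡ countStartingWith P (suc b) (suc n)
    top = begin
      count P (branch (suc b) ++ [])
        ≡⟨ cong (count P) (++-identityʳ (branch (suc b))) ⟩
      count P (map (suc b ∷_) (partitionsBounded n (n ∸ b) (suc b)))
        ≡⟨ count-map P (suc b ∷_) (partitionsBounded n (n ∸ b) (suc b)) ⟩
      count (P ∘ (suc b ∷_)) (partitionsBounded n (n ∸ b) (suc b))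
        ≡⟨ cong (count (P ∘ (suc b ∷_))) (partitionsBounded-fuel (n ∸ b) (suc b) (m∸n≤m n b) ≤-refl) ⟩
      countPartitions (P ∘ (suc b ∷_)) (n ∸ b) (suc b)
        ≡⟨ shift-≤ (λ m → countPartitions (P ∘ (suc b ∷_)) m (suc b)) (s≤s b≤n) ⟨
      countStartingWith P (suc b) (suc n) ∎
  ... | no b≰n = begin
    countPartitions P (suc n) (suc b)
      ≡⟨ countPartitions-stable P (m≤n⇒m≤1+n (≰⇒> b≰n)) ⟩
    countPartitions P (suc n) (suc n)
      ≡⟨ countPartitions-stable P (≰⇒> b≰n) ⟨
    countPartitions P (suc n) b
      ≡⟨ +-identityʳ _ ⟨
    countPartitions P (suc n) b + 0
      ≡⟨ cong (countPartitions P (suc n) b +_) (shift-> (λ m → countPartitions (P ∘ (suc b ∷_)) m (suc b)) (s≤s (≰⇒> b≰n))) ⟨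
    countPartitions P (suc n) b + countStartingWith P (suc b) (suc n) ∎
    where open ≡-Reasoning

  firstPart : List ℕ → ℕ
  firstPart [] = 0
  firstPart (p ∷ _) = p

  firstPart-≤ : ∀ {b n π} → BoundedPartition b n π → firstPart π ≤ b
  firstPart-≤ [] = z≤n
  firstPart-≤ (cons _ p≤b _) = p≤b

  BoundedPartition-tighten : ∀ {b c n π} → BoundedPartition b n π → firstPart π ≤ c → BoundedPartition c n π
  BoundedPartition-tighten [] _ = []
  BoundedPartition-tighten (cons 1≤p _ ρ) p≤c = cons 1≤p p≤c ρ

  BoundedPartition-weaken : ∀ {b c n π} → b ≤ c → BoundedPartition b n π → BoundedPartition c n π
  BoundedPartition-weaken b≤c ρ = BoundedPartition-tighten ρ (≤-trans (firstPart-≤ ρ) b≤c)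

  largest≡firstPart : ∀ {b n π} → BoundedPartition b n π → largest π ≡ firstPart π
  largest≡firstPart [] = refl
  largest≡firstPart (cons _ _ ρ) rewrite largest≡firstPart ρ = m≥n⇒m⊔n≡m (firstPart-≤ ρ)

  length≤ : ∀ {b n π} → BoundedPartition b n π → length π ≤ n
  length≤ [] = z≤n
  length≤ (cons {p = suc p} _ _ ρ) = s≤s (≤-trans (length≤ ρ) (m≤n+m _ p))

  firstPartCount : (List ℕ → Bool) → ℕ → ℕ → ℕ
  firstPartCount P n v = countPartitions (λ π → (firstPart π ≡ᵇ v) ∧ P π) n v

  countPartitions-firstPart : ∀ P n {v b} → v ≤ b →
                              countPartitions (λ π → (firstPart π ≡ᵇ v) ∧ P π) n b ≡ firstPartCount P n v
  countPartitions-firstPart P n {v} v≤b with m≤n⇒m<n∨m≡n v≤b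
  ... | inj₂ refl = refl
  ... | inj₁ (s≤s {n = b} v≤b) = begin
    countPartitions Pᵥ n (suc b)                            ≡⟨ countPartitions-suc Pᵥ n b ⟩
    countPartitions Pᵥ n b + countStartingWith Pᵥ (suc b) n ≡⟨ cong₂ _+_ (countPartitions-firstPart P n v≤b) top ⟩
    firstPartCount P n v + 0                                ≡⟨ +-identityʳ _ ⟩
    firstPartCount P n v                                    ∎
    where
    open ≡-Reasoning
    Pᵥ : List ℕ → Bool
    Pᵥ π = (firstPart π ≡ᵇ v) ∧ P π
    top : countStartingWith Pᵥ (suc b) n ≡ 0
    top = countStartingWith-none Pᵥ (suc b) n λ {_} {r} _ →
      cong (_∧ P (suc b ∷ r)) (dec-false (suc b ≟ v) (>⇒≢ (s≤s v≤b)))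

  countPartitions-byFirstPart : ∀ P n b → countPartitions P n b ≡ sumBelow (suc b) (firstPartCount P n)
  countPartitions-byFirstPart P n b =
    trans (count-split P firstPart (suc b) (All.map (s≤s ∘ firstPart-≤) (partitionsBounded-sound n n b ≤-refl)))
          (sumBelow-cong (suc b) (λ {v} v<1+b →
            trans (countPartitions-cong _ _ n b (λ {π} _ → ∧-comm (P π) (firstPart π ≡ᵇ v)))
                  (countPartitions-firstPart P n (≤-pred v<1+b))))

  firstPartCount-suc : ∀ P n p → firstPartCount P n (suc p) ≡ countStartingWith P (suc p) n
  firstPartCount-suc P n p = begin
    countPartitions Pₚ n (suc p)
      ≡⟨ countPartitions-suc Pₚ n p ⟩
    countPartitions Pₚ n p + countStartingWith Pₚ (suc p) n
      ≡⟨ cong (_+ countStartingWith Pₚ (suc p) n) (countPartitions-none Pₚ n p below) ⟩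
    countStartingWith Pₚ (suc p) n
      ≡⟨ countStartingWith-cong Pₚ P (suc p) n (λ {_} {r} _ → cong (_∧ P (suc p ∷ r)) (≡ᵇ-refl p)) ⟩
    countStartingWith P (suc p) n ∎
    where
    open ≡-Reasoning
    Pₚ : List ℕ → Bool
    Pₚ π = (firstPart π ≡ᵇ suc p) ∧ P π
    below : ∀ {π} → BoundedPartition p n π → Pₚ π ≡ false
    below {π} ρ = cong (_∧ P π) (dec-false (firstPart π ≟ suc p) (<⇒≢ (s≤s (firstPart-≤ ρ))))

  -- Missing integers

  countTo : (ℕ → Bool) → ℕ → ℕ
  countTo g k = count g (map suc (upTo k))

  countTo-suc : ∀ g k → countTo g (suc k) ≡ countTo g k + (if g (suc k) then 1 else 0)
  countTo-suc g k = begin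
    count g (map suc (upTo (suc k)))         ≡⟨ cong (count g ∘ map suc) (upTo-∷ʳ k) ⟨
    count g (map suc (upTo k ++ [ k ]))      ≡⟨ cong (count g) (map-++ suc (upTo k) [ k ]) ⟩
    count g (map suc (upTo k) ++ [ suc k ])  ≡⟨ count-++ g (map suc (upTo k)) [ suc k ] ⟩
    countTo g k + count g [ suc k ]          ≡⟨ cong (countTo g k +_) (trans (count-∷ g (suc k) []) (+-identityʳ _)) ⟩
    countTo g k + (if g (suc k) then 1 else 0) ∎
    where open ≡-Reasoning

  countTo-cong : ∀ k {g g'} → (∀ {i} → i < k → g (suc i) ≡ g' (suc i)) → countTo g k ≡ countTo g' k
  countTo-cong zero _ = refl
  countTo-cong (suc k) {g} {g'} g≗g' =
    trans (countTo-suc g k)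
          (trans (cong₂ (λ c b → c + (if b then 1 else 0)) (countTo-cong k (g≗g' ∘ m<n⇒m<1+n)) (g≗g' ≤-refl))
                 (sym (countTo-suc g' k)))

  countTo-true-above : ∀ g {k c} → k ≤ c → (∀ {i} → k < i → g i ≡ true) → countTo g c ≡ countTo g k + (c ∸ k)
  countTo-true-above g {k} {c} k≤c g≡true with m≤n⇒m<n∨m≡n k≤c
  ... | inj₂ refl = sym (trans (cong (countTo g k +_) (n∸n≡0 k)) (+-identityʳ _))
  ... | inj₁ (s≤s {n = c} k≤c) = begin
    countTo g (suc c)
      ≡⟨ countTo-suc g c ⟩
    countTo g c + (if g (suc c) then 1 else 0)
      ≡⟨ cong₂ (λ x b → x + (if b then 1 else 0)) (countTo-true-above g k≤c g≡true) (g≡true (s≤s k≤c)) ⟩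
    countTo g k + (c ∸ k) + 1
      ≡⟨ +-assoc (countTo g k) (c ∸ k) 1 ⟩
    countTo g k + (c ∸ k + 1)
      ≡⟨ cong (countTo g k +_) (trans (+-comm (c ∸ k) 1) (sym (+-∸-assoc 1 k≤c))) ⟩
    countTo g k + (suc c ∸ k) ∎
    where open ≡-Reasoning

  countTo-false-above : ∀ g {k c} → k ≤ c → (∀ {i} → k < i → g i ≡ false) → countTo g c ≡ countTo g k
  countTo-false-above g {k} {c} k≤c g≡false with m≤n⇒m<n∨m≡n k≤c
  ... | inj₂ refl = refl
  ... | inj₁ (s≤s {n = c} k≤c) =
    trans (countTo-suc g c)
          (trans (cong₂ (λ x b → x + (if b then 1 else 0)) (countTo-false-above g k≤c g≡false) (g≡false (s≤s k≤c)))
                 (+-identityʳ _))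

  -- Consecutive parts p ≥ q leave the p − q − 1 integers strictly between them missing; since
  -- firstPart [] = 0, the last part p also contributes the p − 1 integers below it.
  gaps : List ℕ → ℕ
  gaps [] = 0
  gaps (p ∷ r) = gaps r + (p ∸ suc (firstPart r))

  absent : List ℕ → ℕ → Bool
  absent π i = not (elemᵇ i π)

  elemᵇ-above : ∀ {b s r i} → BoundedPartition b s r → firstPart r < i → elemᵇ i r ≡ false
  elemᵇ-above [] _ = refl
  elemᵇ-above {i = i} (cons {p = q} _ _ ρ) q<i
    rewrite dec-false (i ≟ q) (>⇒≢ q<i) = elemᵇ-above ρ (≤-<-trans (firstPart-≤ ρ) q<i)

  countTo-absent-above : ∀ {b s r c} → BoundedPartition b s r → firstPart r ≤ c →
                         countTo (absent r) c ≡ countTo (absent r) (firstPart r) + (c ∸ firstPart r)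
  countTo-absent-above ρ f≤c = countTo-true-above _ f≤c (cong not ∘ elemᵇ-above ρ)

  countTo-absent-first : ∀ r → countTo (absent r) (firstPart r) ≡ countTo (absent r) (firstPart r ∸ 1)
  countTo-absent-first [] = refl
  countTo-absent-first (zero ∷ r) = refl
  countTo-absent-first (suc q ∷ r) =
    trans (countTo-suc (absent (suc q ∷ r)) q)
          (trans (cong (λ b → countTo (absent (suc q ∷ r)) q + (if not (if b then true else elemᵇ (suc q) r) then 1 else 0))
                       (≡ᵇ-refl q))
                 (+-identityʳ _))

  countTo-absent≡gaps : ∀ {b n π} → BoundedPartition b n π → countTo (absent π) (firstPart π ∸ 1) ≡ gaps π
  countTo-absent≡gaps [] = refl
  countTo-absent≡gaps (cons {p = suc p} {r = r} _ _ ρ) = begin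
    countTo (absent (suc p ∷ r)) p
      ≡⟨ countTo-cong p (λ {i} i<p → cong (λ b → not (if b then true else elemᵇ (suc i) r)) (dec-false (i ≟ p) (<⇒≢ i<p))) ⟩
    countTo (absent r) p
      ≡⟨ below (m≤n⇒m<n∨m≡n (firstPart-≤ ρ)) ⟩
    gaps r + (p ∸ firstPart r) ∎
    where
    open ≡-Reasoning
    ih : countTo (absent r) (firstPart r ∸ 1) ≡ gaps r
    ih = countTo-absent≡gaps ρ
    below : firstPart r < suc p ⊎ firstPart r ≡ suc p → countTo (absent r) p ≡ gaps r + (p ∸ firstPart r)
    below (inj₁ (s≤s f≤p)) =
      trans (countTo-absent-above ρ f≤p) (cong (_+ (p ∸ firstPart r)) (trans (countTo-absent-first r) ih))
    below (inj₂ f≡1+p) = begin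
      countTo (absent r) p                  ≡⟨ cong (countTo (absent r) ∘ (_∸ 1)) f≡1+p ⟨
      countTo (absent r) (firstPart r ∸ 1)  ≡⟨ ih ⟩
      gaps r                                ≡⟨ +-identityʳ _ ⟨
      gaps r + 0                            ≡⟨ cong (gaps r +_) (m≤n⇒m∸n≡0 (≤-trans (n≤1+n p) (≤-reflexive (sym f≡1+p)))) ⟨
      gaps r + (p ∸ firstPart r)            ∎

  length-missing : ∀ {b n π} → BoundedPartition b n π → length (missing π) ≡ gaps π
  length-missing {π = π} ρ = trans (cong (λ L → countTo (absent π) (L ∸ 1)) (largest≡firstPart ρ)) (countTo-absent≡gaps ρ)

  -- Parts occurring once or twice

  distinctParts : List ℕ → Bool
  distinctParts [] = true
  distinctParts (p ∷ r) = not (p ≡ᵇ firstPart r) ∧ distinctParts r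

  oneDoubledPart : List ℕ → Bool
  oneDoubledPart [] = false
  oneDoubledPart (p ∷ []) = false
  oneDoubledPart (p ∷ q ∷ r) = if p ≡ᵇ q then distinctParts (q ∷ r) else oneDoubledPart (q ∷ r)

  doubles : List ℕ → ℕ
  doubles π = countTo (λ v → mult π v ≡ᵇ 2) (largest π)

  atMostTwice : List ℕ → Bool
  atMostTwice π = allᵇ (λ v → mult π v ≤ᵇ 2) π

  mult-∷ : ∀ p r v → mult (p ∷ r) v ≡ (if v ≡ᵇ p then 1 else 0) + mult r v
  mult-∷ p r v = count-∷ (v ≡ᵇ_) p r

  mult-∷-other : ∀ {p v} r → v ≢ p → mult (p ∷ r) v ≡ mult r v
  mult-∷-other {p} {v} r v≢p rewrite mult-∷ p r v | dec-false (v ≟ p) v≢p = refl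

  mult-∷-same : ∀ p r → mult (p ∷ r) p ≡ suc (mult r p)
  mult-∷-same p r rewrite mult-∷ p r p | ≡ᵇ-refl p = refl

  mult-above : ∀ {b s r v} → BoundedPartition b s r → firstPart r < v → mult r v ≡ 0
  mult-above [] _ = refl
  mult-above {v = v} (cons {p = q} {r = r} _ _ ρ) q<v
    rewrite mult-∷ q r v | dec-false (v ≟ q) (>⇒≢ q<v) = mult-above ρ (≤-<-trans (firstPart-≤ ρ) q<v)

  allᵇ-cong : ∀ {c s r} {f f' : ℕ → Bool} → BoundedPartition c s r →
              (∀ {v} → v < c → f (suc v) ≡ f' (suc v)) → allᵇ f r ≡ allᵇ f' r
  allᵇ-cong [] _ = refl
  allᵇ-cong (cons {p = suc q} _ 1+q≤c ρ) f≗f' =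
    cong₂ _∧_ (f≗f' 1+q≤c) (allᵇ-cong ρ (λ v<1+q → f≗f' (<-≤-trans v<1+q 1+q≤c)))

  doubles-top : ∀ π {r s p} → BoundedPartition p s r → largest π ≡ suc p →
                (∀ {v} → v < p → mult π (suc v) ≡ mult r (suc v)) →
                doubles π ≡ doubles r + (if mult π (suc p) ≡ᵇ 2 then 1 else 0)
  doubles-top π {r} {p = p} ρ largest≡1+p same-below = begin
    countTo (twice π) (largest π)          ≡⟨ cong (countTo (twice π)) largest≡1+p ⟩
    countTo (twice π) (suc p)              ≡⟨ countTo-suc (twice π) p ⟩
    countTo (twice π) p + top              ≡⟨ cong (_+ top) (countTo-cong p (cong (_≡ᵇ 2) ∘ same-below)) ⟩
    countTo (twice r) p + top              ≡⟨ cong (_+ top) (countTo-false-above (twice r) (firstPart-≤ ρ) (cong (_≡ᵇ 2) ∘ mult-above ρ)) ⟩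
    countTo (twice r) (firstPart r) + top  ≡⟨ cong (λ L → countTo (twice r) L + top) (largest≡firstPart ρ) ⟨
    doubles r + top                        ∎
    where
    open ≡-Reasoning
    twice : List ℕ → ℕ → Bool
    twice π v = mult π v ≡ᵇ 2
    top : ℕ
    top = if mult π (suc p) ≡ᵇ 2 then 1 else 0

  module _ {p s r} (ρ : BoundedPartition p s r) where

    private
      ρ⁺ : BoundedPartition (suc p) s r
      ρ⁺ = BoundedPartition-weaken (n≤1+n p) ρ

      once : mult (suc p ∷ r) (suc p) ≡ 1
      once = trans (mult-∷-same (suc p) r) (cong suc (mult-above ρ (s≤s (firstPart-≤ ρ))))

      twice : mult (suc p ∷ suc p ∷ r) (suc p) ≡ 2
      twice = trans (mult-∷-same (suc p) (suc p ∷ r)) (cong suc once)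

      single-below : ∀ {v} → v < p → mult (suc p ∷ r) (suc v) ≡ mult r (suc v)
      single-below v<p = mult-∷-other r (<⇒≢ (s≤s v<p))

      pair-below : ∀ {v} → v < p → mult (suc p ∷ suc p ∷ r) (suc v) ≡ mult r (suc v)
      pair-below v<p = trans (mult-∷-other (suc p ∷ r) (<⇒≢ (s≤s v<p))) (single-below v<p)

    doubles-single : doubles (suc p ∷ r) ≡ doubles r
    doubles-single =
      trans (doubles-top (suc p ∷ r) ρ (largest≡firstPart (cons (s≤s z≤n) ≤-refl ρ⁺)) single-below)
            (trans (cong (λ m → doubles r + (if m ≡ᵇ 2 then 1 else 0)) once) (+-identityʳ _))

    atMostTwice-single : atMostTwice (suc p ∷ r) ≡ atMostTwice r
    atMostTwice-single = cong₂ _∧_ (cong (_≤ᵇ 2) once) (allᵇ-cong ρ (cong (_≤ᵇ 2) ∘ single-below))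

    doubles-pair : doubles (suc p ∷ suc p ∷ r) ≡ suc (doubles r)
    doubles-pair =
      trans (doubles-top (suc p ∷ suc p ∷ r) ρ (largest≡firstPart (cons (s≤s z≤n) ≤-refl (cons (s≤s z≤n) ≤-refl ρ⁺))) pair-below)
            (trans (cong (λ m → doubles r + (if m ≡ᵇ 2 then 1 else 0)) twice) (+-comm (doubles r) 1))

    atMostTwice-pair : atMostTwice (suc p ∷ suc p ∷ r) ≡ atMostTwice r
    atMostTwice-pair = cong₂ (λ m a → (m ≤ᵇ 2) ∧ (m ≤ᵇ 2) ∧ a) twice (allᵇ-cong ρ (cong (_≤ᵇ 2) ∘ pair-below))

  atMostTwice-triple : ∀ p r → atMostTwice (p ∷ p ∷ p ∷ r) ≡ false
  atMostTwice-triple p r rewrite mult-∷-same p (p ∷ p ∷ r) | mult-∷-same p (p ∷ r) | mult-∷-same p r = refl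

  oneDoubledPart-∷ : ∀ {p} r → p ≢ firstPart r → oneDoubledPart (p ∷ r) ≡ oneDoubledPart r
  oneDoubledPart-∷ [] _ = refl
  oneDoubledPart-∷ {p} (q ∷ r) p≢q rewrite dec-false (p ≟ q) p≢q = refl

  repetitionPatterns-agree : ∀ {b n π} → BoundedPartition b n π →
                             oneDoubleRestDistinct π ≡ oneDoubledPart π × (doubles π ≡ᵇ 0) ∧ atMostTwice π ≡ distinctParts π
  repetitionPatterns-agree [] = refl , refl
  repetitionPatterns-agree (cons {p = suc p} {s} {r} _ _ ρ) with m≤n⇒m<n∨m≡n (firstPart-≤ ρ)
  ... | inj₁ (s≤s f≤p) = oneDoubled , distinct
    where
    open ≡-Reasoning
    ρ′ : BoundedPartition p s r
    ρ′ = BoundedPartition-tighten ρ f≤p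
    new : suc p ≢ firstPart r
    new = >⇒≢ (s≤s f≤p)
    oneDoubled : oneDoubleRestDistinct (suc p ∷ r) ≡ oneDoubledPart (suc p ∷ r)
    oneDoubled = begin
      (doubles (suc p ∷ r) ≡ᵇ 1) ∧ atMostTwice (suc p ∷ r)
        ≡⟨ cong₂ (λ d a → (d ≡ᵇ 1) ∧ a) (doubles-single ρ′) (atMostTwice-single ρ′) ⟩
      (doubles r ≡ᵇ 1) ∧ atMostTwice r
        ≡⟨ proj₁ (repetitionPatterns-agree ρ) ⟩
      oneDoubledPart r
        ≡⟨ oneDoubledPart-∷ r new ⟨
      oneDoubledPart (suc p ∷ r) ∎
    distinct : (doubles (suc p ∷ r) ≡ᵇ 0) ∧ atMostTwice (suc p ∷ r) ≡ distinctParts (suc p ∷ r)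
    distinct = begin
      (doubles (suc p ∷ r) ≡ᵇ 0) ∧ atMostTwice (suc p ∷ r)
        ≡⟨ cong₂ (λ d a → (d ≡ᵇ 0) ∧ a) (doubles-single ρ′) (atMostTwice-single ρ′) ⟩
      (doubles r ≡ᵇ 0) ∧ atMostTwice r
        ≡⟨ proj₂ (repetitionPatterns-agree ρ) ⟩
      distinctParts r
        ≡⟨ cong (λ b → not b ∧ distinctParts r) (dec-false (suc p ≟ firstPart r) new) ⟨
      distinctParts (suc p ∷ r) ∎
  repetitionPatterns-agree (cons _ _ []) | inj₂ ()
  repetitionPatterns-agree (cons {p = suc p} _ _ (cons {s = s} {r} _ _ ρ)) | inj₂ refl with m≤n⇒m<n∨m≡n (firstPart-≤ ρ)
  ... | inj₁ (s≤s f≤p) = oneDoubled , distinct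
    where
    open ≡-Reasoning
    π : List ℕ
    π = suc p ∷ suc p ∷ r
    ρ′ : BoundedPartition p s r
    ρ′ = BoundedPartition-tighten ρ f≤p
    oneDoubled : oneDoubleRestDistinct π ≡ oneDoubledPart π
    oneDoubled = begin
      (doubles π ≡ᵇ 1) ∧ atMostTwice π
        ≡⟨ cong₂ (λ d a → (d ≡ᵇ 1) ∧ a) (doubles-pair ρ′) (atMostTwice-pair ρ′) ⟩
      (doubles r ≡ᵇ 0) ∧ atMostTwice r
        ≡⟨ proj₂ (repetitionPatterns-agree ρ) ⟩
      distinctParts r
        ≡⟨ cong (λ b → not b ∧ distinctParts r) (dec-false (suc p ≟ firstPart r) (>⇒≢ (s≤s f≤p))) ⟨
      distinctParts (suc p ∷ r)
        ≡⟨ cong (λ b → if b then distinctParts (suc p ∷ r) else oneDoubledPart (suc p ∷ r)) (≡ᵇ-refl p) ⟨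
      oneDoubledPart π ∎
    distinct : (doubles π ≡ᵇ 0) ∧ atMostTwice π ≡ distinctParts π
    distinct = begin
      (doubles π ≡ᵇ 0) ∧ atMostTwice π  ≡⟨ cong (λ d → (d ≡ᵇ 0) ∧ atMostTwice π) (doubles-pair ρ′) ⟩
      false                             ≡⟨ cong (λ b → not b ∧ distinctParts (suc p ∷ r)) (≡ᵇ-refl p) ⟨
      distinctParts π                   ∎
  repetitionPatterns-agree (cons _ _ (cons _ _ [])) | inj₂ refl | inj₂ ()
  repetitionPatterns-agree (cons {p = suc p} _ _ (cons _ _ (cons {r = r} _ _ _))) | inj₂ refl | inj₂ refl =
    trans (atMostTwice-fails 1) (sym (trans (if-doubled (≡ᵇ-refl p)) (not-distinct r)))
    , trans (atMostTwice-fails 0) (sym (not-distinct (suc p ∷ r)))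
    where
    π : List ℕ
    π = suc p ∷ suc p ∷ suc p ∷ r
    atMostTwice-fails : ∀ k → (doubles π ≡ᵇ k) ∧ atMostTwice π ≡ false
    atMostTwice-fails k = trans (cong ((doubles π ≡ᵇ k) ∧_) (atMostTwice-triple (suc p) r)) (∧-zeroʳ _)
    not-distinct : ∀ r → distinctParts (suc p ∷ suc p ∷ r) ≡ false
    not-distinct r = cong (λ b → not b ∧ distinctParts (suc p ∷ r)) (≡ᵇ-refl p)
    if-doubled : (p ≡ᵇ p) ≡ true → oneDoubledPart π ≡ distinctParts (suc p ∷ suc p ∷ r)
    if-doubled = cong (λ b → if b then distinctParts (suc p ∷ suc p ∷ r) else oneDoubledPart (suc p ∷ suc p ∷ r))

  -- Recurrences

  countStartingWith-once : ∀ P Q b n → (∀ {s r} → BoundedPartition b s r → P (suc b ∷ r) ≡ Q r) →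
                           (∀ {s r} → BoundedPartition (suc b) s r → P (suc b ∷ suc b ∷ r) ≡ false) →
                           countStartingWith P (suc b) n ≡ shift (suc b) (λ m → countPartitions Q m b) n
  countStartingWith-once P Q b n new repeated = shift-cong (suc b) n λ m _ → begin
    countPartitions (P ∘ (suc b ∷_)) m (suc b)
      ≡⟨ countPartitions-suc (P ∘ (suc b ∷_)) m b ⟩
    countPartitions (P ∘ (suc b ∷_)) m b + countStartingWith (P ∘ (suc b ∷_)) (suc b) m
      ≡⟨ cong₂ _+_ (countPartitions-cong _ Q m b new) (countStartingWith-none (P ∘ (suc b ∷_)) (suc b) m repeated) ⟩
    countPartitions Q m b + 0
      ≡⟨ +-identityʳ _ ⟩
    countPartitions Q m b ∎
    where open ≡-Reasoning

  -- h constrains the number of parts; h ∘ suc then constrains what is left after removing one part,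
  -- so that (λ l → suc l ≡ᵇ k) asks for k − 1 parts (and for none at all when k = 0).
  distinctCount : (ℕ → Bool) → ℕ → ℕ → ℕ
  distinctCount h = countPartitions (λ π → distinctParts π ∧ h (length π))

  oneDoubledCount : (ℕ → Bool) → ℕ → ℕ → ℕ
  oneDoubledCount h = countPartitions (λ π → oneDoubledPart π ∧ h (length π))

  private
    ≢-above : ∀ {b s r} → BoundedPartition b s r → suc b ≢ firstPart r
    ≢-above ρ = >⇒≢ (s≤s (firstPart-≤ ρ))

  distinctCount-suc : ∀ h n b → distinctCount h n (suc b) ≡
                      distinctCount h n b + shift (suc b) (λ m → distinctCount (h ∘ suc) m b) n
  distinctCount-suc h n b =
    trans (countPartitions-suc P n b)
          (cong (distinctCount h n b +_) (countStartingWith-once P (λ r → distinctParts r ∧ h (suc (length r))) b n single pair))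
    where
    P : List ℕ → Bool
    P π = distinctParts π ∧ h (length π)
    single : ∀ {s r} → BoundedPartition b s r → P (suc b ∷ r) ≡ distinctParts r ∧ h (suc (length r))
    single {r = r} ρ = cong (λ x → (not x ∧ distinctParts r) ∧ h (suc (length r))) (dec-false (suc b ≟ firstPart r) (≢-above ρ))
    pair : ∀ {s r} → BoundedPartition (suc b) s r → P (suc b ∷ suc b ∷ r) ≡ false
    pair {r = r} _ = cong (λ x → (not x ∧ distinctParts (suc b ∷ r)) ∧ h (suc (suc (length r)))) (≡ᵇ-refl b)

  oneDoubledCount-suc : ∀ h n b → oneDoubledCount h n (suc b) ≡
    oneDoubledCount h n b +
    shift (suc b) (λ m → oneDoubledCount (h ∘ suc) m b + shift (suc b) (λ m′ → distinctCount (h ∘ suc ∘ suc) m′ b) m) n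
  oneDoubledCount-suc h n b =
    trans (countPartitions-suc P n b) (cong (oneDoubledCount h n b +_) (shift-cong (suc b) n λ m _ →
      trans (countPartitions-suc (P ∘ (suc b ∷_)) m b)
            (cong₂ _+_ (countPartitions-cong (P ∘ (suc b ∷_)) (λ r → oneDoubledPart r ∧ h (suc (length r))) m b single)
                       (countStartingWith-once (P ∘ (suc b ∷_)) (λ r → distinctParts r ∧ h (suc (suc (length r)))) b m pair triple))))
    where
    P : List ℕ → Bool
    P π = oneDoubledPart π ∧ h (length π)
    single : ∀ {s r} → BoundedPartition b s r → P (suc b ∷ r) ≡ oneDoubledPart r ∧ h (suc (length r))
    single {r = r} ρ = cong (_∧ h (suc (length r))) (oneDoubledPart-∷ r (≢-above ρ))
    pair : ∀ {s r} → BoundedPartition b s r → P (suc b ∷ suc b ∷ r) ≡ distinctParts r ∧ h (suc (suc (length r)))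
    pair {r = r} ρ = cong (_∧ h (suc (suc (length r))))
      (trans (cong (λ x → if x then distinctParts (suc b ∷ r) else oneDoubledPart (suc b ∷ r)) (≡ᵇ-refl b))
             (cong (λ x → not x ∧ distinctParts r) (dec-false (suc b ≟ firstPart r) (≢-above ρ))))
    triple : ∀ {s r} → BoundedPartition (suc b) s r → P (suc b ∷ suc b ∷ suc b ∷ r) ≡ false
    triple {r = r} _ = cong (_∧ h (suc (suc (suc (length r)))))
      (trans (cong (λ x → if x then distinctParts (suc b ∷ suc b ∷ r) else oneDoubledPart (suc b ∷ suc b ∷ r)) (≡ᵇ-refl b))
             (cong (λ x → not x ∧ distinctParts (suc b ∷ r)) (≡ᵇ-refl b)))

  distinctCount-never : ∀ n b → distinctCount (λ _ → false) n b ≡ 0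
  distinctCount-never n b = countPartitions-none _ n b (λ _ → ∧-zeroʳ _)

  oneDoubledCount-never : ∀ n b → oneDoubledCount (λ _ → false) n b ≡ 0
  oneDoubledCount-never n b = countPartitions-none _ n b (λ _ → ∧-zeroʳ _)

  BoundedPartition-0 : ∀ {n π} → BoundedPartition 0 n π → π ≡ []
  BoundedPartition-0 [] = refl
  BoundedPartition-0 (cons 1≤p p≤0 _) = ⊥-elim (<⇒≱ 1≤p p≤0)

  distinctCount-bound0 : ∀ h n → h 0 ≡ false → distinctCount h n 0 ≡ 0
  distinctCount-bound0 h n h0≡false = countPartitions-none _ n 0 λ ρ →
    subst (λ π → distinctParts π ∧ h (length π) ≡ false) (sym (BoundedPartition-0 ρ)) h0≡false

  oneDoubledCount-bound0 : ∀ h n → oneDoubledCount h n 0 ≡ 0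
  oneDoubledCount-bound0 h n = countPartitions-none _ n 0 λ ρ →
    subst (λ π → oneDoubledPart π ∧ h (length π) ≡ false) (sym (BoundedPartition-0 ρ)) refl

  shift-distinctCount-bound0 : ∀ a j n → shift a (λ m → distinctCount (_≡ᵇ j) m 0) n ≡
                                         shift (a + j) (λ m → distinctCount (_≡ᵇ j) m 0) n
  shift-distinctCount-bound0 a zero n = cong (λ c → shift c (λ m → distinctCount (_≡ᵇ 0) m 0) n) (sym (+-identityʳ a))
  shift-distinctCount-bound0 a (suc j) n = trans (vanish a) (sym (vanish (a + suc j)))
    where
    vanish : ∀ c → shift c (λ m → distinctCount (_≡ᵇ suc j) m 0) n ≡ 0
    vanish c = trans (shift-cong c n (λ m _ → distinctCount-bound0 (_≡ᵇ suc j) m refl)) (shift-const c n)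

  -- Subtracting 1 from each of the k distinct parts leaves k distinct parts, or k − 1 of them when
  -- the smallest part was 1; the bound on the parts drops by one.  The same bookkeeping, with a part 1
  -- occurring once or twice, gives oneDoubledCount-conjugate below.
  distinctCount-conjugate : ∀ b k n → distinctCount (_≡ᵇ k) n (suc b) ≡
                            shift k (λ m → distinctCount (_≡ᵇ k) m b + distinctCount (λ l → suc l ≡ᵇ k) m b) n
  distinctCount-conjugate b zero n =
    trans (distinctCount-suc (_≡ᵇ 0) n b)
          (cong (distinctCount (_≡ᵇ 0) n b +_)
                (trans (shift-cong (suc b) n (λ m _ → distinctCount-never m b))
                       (trans (shift-const (suc b) n) (sym (distinctCount-never n b)))))
  distinctCount-conjugate zero (suc k) n = begin
    D (suc k) n 1
      ≡⟨ distinctCount-suc (_≡ᵇ suc k) n 0 ⟩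
    D (suc k) n 0 + shift 1 (λ m → D k m 0) n
      ≡⟨ cong (_+ shift 1 (λ m → D k m 0) n) (distinctCount-bound0 (_≡ᵇ suc k) n refl) ⟩
    shift 1 (λ m → D k m 0) n
      ≡⟨ shift-distinctCount-bound0 1 k n ⟩
    shift (suc k) (λ m → D k m 0) n
      ≡⟨ shift-cong (suc k) n (λ m _ → cong (_+ D k m 0) (distinctCount-bound0 (_≡ᵇ suc k) m refl)) ⟨
    shift (suc k) (λ m → D (suc k) m 0 + D k m 0) n ∎
    where
    open ≡-Reasoning
    D : ℕ → ℕ → ℕ → ℕ
    D k = distinctCount (_≡ᵇ k)
  distinctCount-conjugate (suc b) (suc k) n = begin
    D K n (suc b′)
      ≡⟨ distinctCount-suc (_≡ᵇ K) n b′ ⟩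
    D K n b′ + shift (suc b′) (λ m → D k m b′) n
      ≡⟨ cong₂ _+_ (distinctCount-conjugate b K n) (shift-cong (suc b′) n (λ m _ → distinctCount-conjugate b k m)) ⟩
    shift K F n + shift (suc b′) (shift k G) n
      ≡⟨ cong (shift K F n +_) (shift-shift (suc b′) k n G) ⟩
    shift K F n + shift (suc b′ + k) G n
      ≡⟨ cong (λ a → shift K F n + shift a G n) (cong suc (+-comm b′ k)) ⟩
    shift K F n + shift (K + b′) G n
      ≡⟨ cong (shift K F n +_) (shift-shift K b′ n G) ⟨
    shift K F n + shift K (shift b′ G) n
      ≡⟨ shift-+ K n F (shift b′ G) ⟨
    shift K (λ m → F m + shift b′ G m) n
      ≡⟨ shift-cong K n (λ m _ → regroup m) ⟩
    shift K (λ m → D K m b′ + D k m b′) n ∎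
    where
    open ≡-Reasoning
    D : ℕ → ℕ → ℕ → ℕ
    D k = distinctCount (_≡ᵇ k)
    D′ : ℕ → ℕ → ℕ
    D′ = distinctCount (λ l → suc l ≡ᵇ k)
    K b′ : ℕ
    K = suc k
    b′ = suc b
    F G : ℕ → ℕ
    F m = D K m b + D k m b
    G m = D k m b + D′ m b
    regroup : ∀ m → F m + shift b′ G m ≡ D K m b′ + D k m b′
    regroup m = begin
      (D K m b + D k m b) + shift b′ G m
        ≡⟨ cong (F m +_) (shift-+ b′ m (λ x → D k x b) (λ x → D′ x b)) ⟩
      (D K m b + D k m b) + (shift b′ (λ x → D k x b) m + shift b′ (λ x → D′ x b) m)
        ≡⟨ interchange (D K m b) (D k m b) _ _ ⟩
      (D K m b + shift b′ (λ x → D k x b) m) + (D k m b + shift b′ (λ x → D′ x b) m)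
        ≡⟨ cong₂ _+_ (distinctCount-suc (_≡ᵇ K) m b) (distinctCount-suc (_≡ᵇ k) m b) ⟨
      D K m b′ + D k m b′ ∎

  oneDoubledCount-short : ∀ k n b → k < 2 → oneDoubledCount (_≡ᵇ k) n b ≡ 0
  oneDoubledCount-short k n b k<2 = countPartitions-none _ n b λ {π} _ → short π
    where
    short : ∀ π → oneDoubledPart π ∧ (length π ≡ᵇ k) ≡ false
    short [] = refl
    short (_ ∷ []) = refl
    short (p ∷ q ∷ r) =
      trans (cong (oneDoubledPart (p ∷ q ∷ r) ∧_) (dec-false (2 + length r ≟ k) (<⇒≢ (<-≤-trans k<2 (s≤s (s≤s z≤n))) ∘ sym)))
            (∧-zeroʳ _)

  oneDoubledCount-conjugate : ∀ b k n → oneDoubledCount (_≡ᵇ k) n (suc b) ≡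
    shift k (λ m → oneDoubledCount (_≡ᵇ k) m b + oneDoubledCount (λ l → suc l ≡ᵇ k) m b + distinctCount (λ l → suc (suc l) ≡ᵇ k) m b) n
  oneDoubledCount-conjugate b zero n =
    trans (oneDoubledCount-short 0 n (suc b) (s≤s z≤n))
          (sym (cong₂ _+_ (cong₂ _+_ (oneDoubledCount-short 0 n b (s≤s z≤n)) (oneDoubledCount-never n b)) (distinctCount-never n b)))
  oneDoubledCount-conjugate b (suc zero) n =
    trans (oneDoubledCount-short 1 n (suc b) ≤-refl)
          (sym (trans (shift-cong 1 n (λ m _ → cong₂ _+_ (cong₂ _+_ (oneDoubledCount-short 1 m b ≤-refl) (oneDoubledCount-short 0 m b (s≤s z≤n)))
                                                        (distinctCount-never m b)))
                      (shift-const 1 n)))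
  oneDoubledCount-conjugate zero (suc (suc j)) n = begin
    O K n 1
      ≡⟨ oneDoubledCount-suc (_≡ᵇ K) n 0 ⟩
    O K n 0 + shift 1 (λ m → O (suc j) m 0 + shift 1 (λ m′ → D j m′ 0) m) n
      ≡⟨ cong₂ _+_ (oneDoubledCount-bound0 (_≡ᵇ K) n)
                   (shift-cong 1 n λ m _ → cong (_+ shift 1 (λ m′ → D j m′ 0) m) (oneDoubledCount-bound0 (_≡ᵇ suc j) m)) ⟩
    shift 1 (shift 1 (λ m′ → D j m′ 0)) n
      ≡⟨ shift-shift 1 1 n (λ m′ → D j m′ 0) ⟩
    shift 2 (λ m → D j m 0) n
      ≡⟨ shift-distinctCount-bound0 2 j n ⟩
    shift K (λ m → D j m 0) n
      ≡⟨ shift-cong K n (λ m _ → cong₂ (λ x y → x + y + D j m 0) (oneDoubledCount-bound0 (_≡ᵇ K) m)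
                                                                 (oneDoubledCount-bound0 (_≡ᵇ suc j) m)) ⟨
    shift K (λ m → O K m 0 + O (suc j) m 0 + D j m 0) n ∎
    where
    open ≡-Reasoning
    O D : ℕ → ℕ → ℕ → ℕ
    O k = oneDoubledCount (_≡ᵇ k)
    D k = distinctCount (_≡ᵇ k)
    K = suc (suc j)
  oneDoubledCount-conjugate (suc b) (suc (suc j)) n = begin
    O k₂ n (suc b′)
      ≡⟨ oneDoubledCount-suc (_≡ᵇ k₂) n b′ ⟩
    O k₂ n b′ + shift (suc b′) (λ x → O k₁ x b′ + shift (suc b′) (λ y → D j y b′) x) n
      ≡⟨ cong₂ _+_ (oneDoubledCount-conjugate b k₂ n)
                   (shift-cong (suc b′) n λ x _ → cong₂ _+_ (oneDoubledCount-conjugate b k₁ x)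
                                                            (shift-cong (suc b′) x λ y _ → distinctCount-conjugate b j y)) ⟩
    shift k₂ F n + shift (suc b′) (λ x → shift k₁ F₁ x + shift (suc b′) (shift j F₂) x) n
      ≡⟨ cong (shift k₂ F n +_) (trans (shift-+ (suc b′) n (shift k₁ F₁) (shift (suc b′) (shift j F₂)))
                                      (cong₂ _+_ moveOut₁ moveOut₂)) ⟩
    shift k₂ F n + (shift k₂ (shift b′ F₁) n + shift k₂ (shift b′ (shift b′ F₂)) n)
      ≡⟨ cong (shift k₂ F n +_) (shift-+ k₂ n (shift b′ F₁) (shift b′ (shift b′ F₂))) ⟨
    shift k₂ F n + shift k₂ (λ m → shift b′ F₁ m + shift b′ (shift b′ F₂) m) n
      ≡⟨ shift-+ k₂ n F (λ m → shift b′ F₁ m + shift b′ (shift b′ F₂) m) ⟨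
    shift k₂ (λ m → F m + (shift b′ F₁ m + shift b′ (shift b′ F₂) m)) n
      ≡⟨ shift-cong k₂ n (λ m _ → regroup m) ⟩
    shift k₂ (λ m → O k₂ m b′ + O k₁ m b′ + D j m b′) n ∎
    where
    open ≡-Reasoning
    O D : ℕ → ℕ → ℕ → ℕ
    O k = oneDoubledCount (_≡ᵇ k)
    D k = distinctCount (_≡ᵇ k)
    D′ : ℕ → ℕ → ℕ
    D′ = distinctCount (λ l → suc l ≡ᵇ j)
    k₁ k₂ b′ : ℕ
    k₁ = suc j
    k₂ = suc k₁
    b′ = suc b
    F F₁ F₂ : ℕ → ℕ
    F m = O k₂ m b + O k₁ m b + D j m b
    F₁ m = O k₁ m b + O j m b + D′ m b
    F₂ m = D j m b + D′ m b
    moveOut₁ : shift (suc b′) (shift k₁ F₁) n ≡ shift k₂ (shift b′ F₁) n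
    moveOut₁ = begin
      shift (suc b′) (shift k₁ F₁) n ≡⟨ shift-shift (suc b′) k₁ n F₁ ⟩
      shift (suc b′ + k₁) F₁ n       ≡⟨ cong (λ c → shift c F₁ n) (cong suc (+-comm b′ k₁)) ⟩
      shift (k₂ + b′) F₁ n           ≡⟨ shift-shift k₂ b′ n F₁ ⟨
      shift k₂ (shift b′ F₁) n       ∎
    moveOut₂ : shift (suc b′) (shift (suc b′) (shift j F₂)) n ≡ shift k₂ (shift b′ (shift b′ F₂)) n
    moveOut₂ = begin
      shift (suc b′) (shift (suc b′) (shift j F₂)) n  ≡⟨ shift-cong (suc b′) n (λ x _ → shift-shift (suc b′) j x F₂) ⟩
      shift (suc b′) (shift (suc b′ + j) F₂) n        ≡⟨ shift-shift (suc b′) (suc b′ + j) n F₂ ⟩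
      shift (suc b′ + (suc b′ + j)) F₂ n              ≡⟨ cong (λ c → shift c F₂ n) (exponent b′ j) ⟩
      shift (k₂ + (b′ + b′)) F₂ n                      ≡⟨ shift-shift k₂ (b′ + b′) n F₂ ⟨
      shift k₂ (shift (b′ + b′) F₂) n                  ≡⟨ shift-cong k₂ n (λ x _ → shift-shift b′ b′ x F₂) ⟨
      shift k₂ (shift b′ (shift b′ F₂)) n              ∎
      where
      exponent : ∀ b j → suc b + (suc b + j) ≡ suc (suc j) + (b + b)
      exponent = solve-∀
    regroup : ∀ m → F m + (shift b′ F₁ m + shift b′ (shift b′ F₂) m) ≡ O k₂ m b′ + O k₁ m b′ + D j m b′
    regroup m = begin
      F m + (shift b′ F₁ m + shift b′ (shift b′ F₂) m)
        ≡⟨ cong (λ x → F m + x) (cong₂ _+_ (trans (shift-+ b′ m (λ y → O k₁ y b + O j y b) (λ y → D′ y b))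
                                                  (cong (_+ shift b′ (λ y → D′ y b) m) (shift-+ b′ m (λ y → O k₁ y b) (λ y → O j y b))))
                                           (trans (shift-cong b′ m (λ y _ → shift-+ b′ y (λ z → D j z b) (λ z → D′ z b)))
                                                  (shift-+ b′ m (shift b′ (λ z → D j z b)) (shift b′ (λ z → D′ z b))))) ⟩
      F m + ((sOk₁ + sOj + sD′) + (ssDj + ssD′))
        ≡⟨ rearrange (O k₂ m b) (O k₁ m b) (D j m b) sOk₁ sOj sD′ ssDj ssD′ ⟩
      (O k₂ m b + (sOk₁ + ssDj)) + (O k₁ m b + (sOj + ssD′)) + (D j m b + sD′)
        ≡⟨ cong₂ _+_ (cong₂ _+_ (cong (O k₂ m b +_) (shift-+ b′ m (λ y → O k₁ y b) (shift b′ (λ z → D j z b))))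
                                 (cong (O k₁ m b +_) (shift-+ b′ m (λ y → O j y b) (shift b′ (λ z → D′ z b))))) refl ⟨
      (O k₂ m b + shift b′ (λ y → O k₁ y b + shift b′ (λ z → D j z b) y) m)
        + (O k₁ m b + shift b′ (λ y → O j y b + shift b′ (λ z → D′ z b) y) m)
        + (D j m b + shift b′ (λ z → D′ z b) m)
        ≡⟨ cong₂ _+_ (cong₂ _+_ (oneDoubledCount-suc (_≡ᵇ k₂) m b) (oneDoubledCount-suc (_≡ᵇ k₁) m b)) (distinctCount-suc (_≡ᵇ j) m b) ⟨
      O k₂ m b′ + O k₁ m b′ + D j m b′ ∎
      where
      sOk₁ sOj sD′ ssDj ssD′ : ℕ
      sOk₁ = shift b′ (λ y → O k₁ y b) m
      sOj = shift b′ (λ y → O j y b) m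
      sD′ = shift b′ (λ y → D′ y b) m
      ssDj = shift b′ (shift b′ (λ z → D j z b)) m
      ssD′ = shift b′ (shift b′ (λ z → D′ z b)) m
      rearrange : ∀ a c e f g h i k → a + c + e + ((f + g + h) + (i + k)) ≡ (a + (f + i)) + (c + (g + k)) + (e + h)
      rearrange = solve-∀

  gapCount : ℕ → ℕ → ℕ → ℕ
  gapCount j = firstPartCount (λ π → gaps π ≡ᵇ j)

  ∧-congˡ-T : ∀ b {x y} → (T b → x ≡ y) → b ∧ x ≡ b ∧ y
  ∧-congˡ-T true x≡y = x≡y _
  ∧-congˡ-T false _ = refl

  firstPartCount-cong : ∀ P P' n v → (∀ {π} → BoundedPartition v n π → firstPart π ≡ v → P π ≡ P' π) →
                        firstPartCount P n v ≡ firstPartCount P' n v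
  firstPartCount-cong P P' n v P≗P' =
    countPartitions-cong _ _ n v λ {π} ρ → ∧-congˡ-T (firstPart π ≡ᵇ v) (P≗P' ρ ∘ ≡ᵇ⇒≡ (firstPart π) v)

  +-≡ᵇ : ∀ x {c j} → c ≤ j → (x + c ≡ᵇ j) ≡ (x ≡ᵇ j ∸ c)
  +-≡ᵇ x {zero} _ = cong (_≡ᵇ _) (+-identityʳ x)
  +-≡ᵇ x {suc c} {suc j} (s≤s c≤j) = trans (cong (_≡ᵇ suc j) (+-suc x c)) (+-≡ᵇ x c≤j)

  gapCount-suc : ∀ j n p → gapCount j n (suc p) ≡
                 shift (suc p) (λ m → sumBelow (suc (suc p)) (λ v → firstPartCount (λ r → gaps r + (p ∸ v) ≡ᵇ j) m v)) n
  gapCount-suc j n p =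
    trans (firstPartCount-suc _ n p) (shift-cong (suc p) n λ m _ →
      trans (countPartitions-byFirstPart _ m (suc p)) (sumBelow-cong (suc (suc p)) λ {v} _ →
        firstPartCount-cong _ _ m v λ {r} _ first≡v → cong (λ f → gaps r + (p ∸ f) ≡ᵇ j) first≡v))

  gapTerm-excess : ∀ j p m v → j < p ∸ v → firstPartCount (λ r → gaps r + (p ∸ v) ≡ᵇ j) m v ≡ 0
  gapTerm-excess j p m v j<p∸v = countPartitions-none _ m v λ {r} _ →
    trans (cong ((firstPart r ≡ᵇ v) ∧_) (dec-false (gaps r + (p ∸ v) ≟ j) (>⇒≢ (<-≤-trans j<p∸v (m≤n+m (p ∸ v) (gaps r))))))
          (∧-zeroʳ _)

  gapTerm-exact : ∀ j p m v → p ∸ v ≤ j → firstPartCount (λ r → gaps r + (p ∸ v) ≡ᵇ j) m v ≡ gapCount (j ∸ (p ∸ v)) m v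
  gapTerm-exact j p m v p∸v≤j = firstPartCount-cong _ _ m v λ {r} _ _ → +-≡ᵇ (gaps r) p∸v≤j

  gapCount-zero-suc : ∀ n p → gapCount 0 n (suc p) ≡ shift (suc p) (λ m → gapCount 0 m p + gapCount 0 m (suc p)) n
  gapCount-zero-suc n p = trans (gapCount-suc 0 n p) (shift-cong (suc p) n λ m _ →
    cong₂ _+_ (cong₂ _+_ (sumBelow-zero p (λ {v} v<p → gapTerm-excess 0 p m v (m<n⇒0<n∸m v<p)))
                         (trans (gapTerm-exact 0 p m p (≤-reflexive (n∸n≡0 p))) (cong (λ k → gapCount (0 ∸ k) m p) (n∸n≡0 p))))
              (trans (gapTerm-exact 0 p m (suc p) (≤-reflexive p∸1+p≡0)) (cong (λ k → gapCount (0 ∸ k) m (suc p)) p∸1+p≡0)))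
    where
    p∸1+p≡0 : p ∸ suc p ≡ 0
    p∸1+p≡0 = m≤n⇒m∸n≡0 (n≤1+n p)

  previous : (ℕ → ℕ) → ℕ → ℕ
  previous f zero = 0
  previous f (suc k) = f k

  gapCount-one-suc : ∀ n p → gapCount 1 n (suc p) ≡
                     shift (suc p) (λ m → previous (gapCount 0 m) p + gapCount 1 m p + gapCount 1 m (suc p)) n
  gapCount-one-suc n p = trans (gapCount-suc 1 n p) (shift-cong (suc p) n λ m _ → terms m p)
    where
    terms : ∀ m p → sumBelow (suc (suc p)) (λ v → firstPartCount (λ r → gaps r + (p ∸ v) ≡ᵇ 1) m v) ≡
                    previous (gapCount 0 m) p + gapCount 1 m p + gapCount 1 m (suc p)
    terms m zero = cong₂ _+_ (gapTerm-exact 1 0 m 0 z≤n) (gapTerm-exact 1 0 m 1 z≤n)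
    terms m (suc p) = cong₂ _+_ (cong₂ _+_ (cong₂ _+_ (sumBelow-zero p far) (at p 1 (m+n∸n≡m 1 p) ≤-refl)) (at (suc p) 0 (n∸n≡0 p) z≤n))
                                (at (suc (suc p)) 0 (m≤n⇒m∸n≡0 (n≤1+n p)) z≤n)
      where
      term : ℕ → ℕ
      term v = firstPartCount (λ r → gaps r + (suc p ∸ v) ≡ᵇ 1) m v
      far : ∀ {v} → v < p → term v ≡ 0
      far {v} v<p = gapTerm-excess 1 (suc p) m v (subst (1 <_) (sym (+-∸-assoc 1 (<⇒≤ v<p))) (s≤s (m<n⇒0<n∸m v<p)))
      at : ∀ v c → suc p ∸ v ≡ c → c ≤ 1 → term v ≡ gapCount (1 ∸ c) m v
      at v c eq c≤1 = trans (gapTerm-exact 1 (suc p) m v (≤-trans (≤-reflexive eq) c≤1)) (cong (λ c → gapCount (1 ∸ c) m v) eq)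

  distinctCount-stable : ∀ h {n b} → n ≤ b → distinctCount h n b ≡ distinctCount h n n
  distinctCount-stable h = countPartitions-stable (λ π → distinctParts π ∧ h (length π))

  oneDoubledCount-stable : ∀ h {n b} → n ≤ b → oneDoubledCount h n b ≡ oneDoubledCount h n n
  oneDoubledCount-stable h = countPartitions-stable (λ π → oneDoubledPart π ∧ h (length π))

  module _ (k n : ℕ) where
    private
      below-diagonal : ∀ {m} → m + k ≡ n → m ≤ n
      below-diagonal {m} m+k≡n = subst (m ≤_) m+k≡n (m≤m+n m k)

    distinctCount-conjugate-diag : distinctCount (_≡ᵇ k) n n ≡
                                   shift k (λ m → distinctCount (_≡ᵇ k) m m + distinctCount (λ l → suc l ≡ᵇ k) m m) n
    distinctCount-conjugate-diag =
      trans (sym (distinctCount-stable (_≡ᵇ k) (n≤1+n n)))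
            (trans (distinctCount-conjugate n k n)
                   (shift-cong k n λ m m+k≡n → cong₂ _+_ (distinctCount-stable (_≡ᵇ k) (below-diagonal m+k≡n))
                                                         (distinctCount-stable (λ l → suc l ≡ᵇ k) (below-diagonal m+k≡n))))

    oneDoubledCount-conjugate-diag : oneDoubledCount (_≡ᵇ k) n n ≡
      shift k (λ m → oneDoubledCount (_≡ᵇ k) m m + oneDoubledCount (λ l → suc l ≡ᵇ k) m m + distinctCount (λ l → suc (suc l) ≡ᵇ k) m m) n
    oneDoubledCount-conjugate-diag =
      trans (sym (oneDoubledCount-stable (_≡ᵇ k) (n≤1+n n)))
            (trans (oneDoubledCount-conjugate n k n)
                   (shift-cong k n λ m m+k≡n → cong₂ _+_ (cong₂ _+_ (oneDoubledCount-stable (_≡ᵇ k) (below-diagonal m+k≡n))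
                                                                    (oneDoubledCount-stable (λ l → suc l ≡ᵇ k) (below-diagonal m+k≡n)))
                                                         (distinctCount-stable (λ l → suc (suc l) ≡ᵇ k) (below-diagonal m+k≡n))))

  distinctCount-length0 : ∀ n b → distinctCount (_≡ᵇ 0) (suc n) b ≡ 0
  distinctCount-length0 n b = countPartitions-none _ (suc n) b λ {π} ρ → trans (cong (distinctParts π ∧_) (nonempty ρ)) (∧-zeroʳ _)
    where
    nonempty : ∀ {π} → BoundedPartition b (suc n) π → (length π ≡ᵇ 0) ≡ false
    nonempty {_ ∷ _} _ = refl

  private
    smaller : ∀ {m k n} → m + suc k ≡ n → m < n
    smaller {m} m+1+k≡n = subst (m <_) m+1+k≡n (m<m+n m (s≤s z≤n))

  gapCount-zero≡distinctCount : ∀ n k → gapCount 0 n k ≡ distinctCount (_≡ᵇ k) n n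
  gapCount-zero≡distinctCount = <-rec _ step
    where
    step : ∀ n → (∀ {m} → m < n → ∀ k → gapCount 0 m k ≡ distinctCount (_≡ᵇ k) m m) →
           ∀ k → gapCount 0 n k ≡ distinctCount (_≡ᵇ k) n n
    step zero _ zero = refl
    step (suc n) _ zero = sym (distinctCount-length0 n (suc n))
    step n rec (suc k) = begin
      gapCount 0 n (suc k)
        ≡⟨ gapCount-zero-suc n k ⟩
      shift (suc k) (λ m → gapCount 0 m k + gapCount 0 m (suc k)) n
        ≡⟨ shift-cong (suc k) n (λ m eq → cong₂ _+_ (rec (smaller eq) k) (rec (smaller eq) (suc k))) ⟩
      shift (suc k) (λ m → D k m m + D (suc k) m m) n
        ≡⟨ shift-cong (suc k) n (λ m _ → +-comm (D k m m) (D (suc k) m m)) ⟩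
      shift (suc k) (λ m → D (suc k) m m + D k m m) n
        ≡⟨ distinctCount-conjugate-diag (suc k) n ⟨
      D (suc k) n n ∎
      where
      open ≡-Reasoning
      D : ℕ → ℕ → ℕ → ℕ
      D k = distinctCount (_≡ᵇ k)

  gapCount-one≡oneDoubledCount : ∀ n k → gapCount 1 n k ≡ oneDoubledCount (_≡ᵇ k) n n
  gapCount-one≡oneDoubledCount = <-rec _ step
    where
    step : ∀ n → (∀ {m} → m < n → ∀ k → gapCount 1 m k ≡ oneDoubledCount (_≡ᵇ k) m m) →
           ∀ k → gapCount 1 n k ≡ oneDoubledCount (_≡ᵇ k) n n
    step zero _ zero = refl
    step (suc n) _ zero = sym (oneDoubledCount-short 0 (suc n) (suc n) (s≤s z≤n))
    step n rec (suc k) = begin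
      gapCount 1 n (suc k)
        ≡⟨ gapCount-one-suc n k ⟩
      shift (suc k) (λ m → previous (gapCount 0 m) k + gapCount 1 m k + gapCount 1 m (suc k)) n
        ≡⟨ shift-cong (suc k) n (λ m eq → cong₂ _+_ (cong₂ _+_ (previous-gapCount m k) (rec (smaller eq) k)) (rec (smaller eq) (suc k))) ⟩
      shift (suc k) (λ m → D′ m m + O k m m + O (suc k) m m) n
        ≡⟨ shift-cong (suc k) n (λ m _ → reverse (D′ m m) (O k m m) (O (suc k) m m)) ⟩
      shift (suc k) (λ m → O (suc k) m m + O k m m + D′ m m) n
        ≡⟨ oneDoubledCount-conjugate-diag (suc k) n ⟨
      O (suc k) n n ∎
      where
      open ≡-Reasoning
      O : ℕ → ℕ → ℕ → ℕ
      O k = oneDoubledCount (_≡ᵇ k)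
      D′ : ℕ → ℕ → ℕ
      D′ = distinctCount (λ l → suc l ≡ᵇ k)
      previous-gapCount : ∀ m k → previous (gapCount 0 m) k ≡ distinctCount (λ l → suc l ≡ᵇ k) m m
      previous-gapCount m zero = sym (distinctCount-never m m)
      previous-gapCount m (suc k) = gapCount-zero≡distinctCount m k
      reverse : ∀ a b c → a + b + c ≡ c + b + a
      reverse = solve-∀

  P1≡sum-gapCount : ∀ n → P1 n ≡ sumBelow (suc n) (gapCount 1 n)
  P1≡sum-gapCount n = trans (countPartitions-cong _ _ n n (cong (_≡ᵇ 1) ∘ length-missing)) (countPartitions-byFirstPart _ n n)

  Q≡countPartitions : ∀ n → Q n ≡ countPartitions oneDoubledPart n n
  Q≡countPartitions n = countPartitions-cong _ _ n n (proj₁ ∘ repetitionPatterns-agree)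

  Q≡sum-oneDoubledCount : ∀ n → Q n ≡ sumBelow (suc n) (λ k → oneDoubledCount (_≡ᵇ k) n n)
  Q≡sum-oneDoubledCount n =
    trans (Q≡countPartitions n)
          (count-split oneDoubledPart length (suc n) (All.map (s≤s ∘ length≤) (partitionsBounded-sound n n n ≤-refl)))

  P1≡Q : ∀ n → P1 n ≡ Q n
  P1≡Q n = begin
    P1 n                                                 ≡⟨ P1≡sum-gapCount n ⟩
    sumBelow (suc n) (gapCount 1 n)                      ≡⟨ sumBelow-cong (suc n) (λ {k} _ → gapCount-one≡oneDoubledCount n k) ⟩
    sumBelow (suc n) (λ k → oneDoubledCount (_≡ᵇ k) n n) ≡⟨ Q≡sum-oneDoubledCount n ⟨
    Q n                                                  ∎
    where open ≡-Reasoning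

module Series where

  open import Data.Bool using (true; false; if_then_else_)
  open import Data.Bool.Properties using (∧-identityʳ)
  open import Data.Nat as ℕ using (ℕ; zero; suc; _∸_; _≤_; _<_; s≤s; _≤?_; _≟_; _≤ᵇ_; _≡ᵇ_)
  import Data.Nat.Properties as ℕₚ
  open import Data.Integer using (ℤ; +_; -_; _+_; _*_)
  open import Data.Integer.Properties
    using (+-assoc; +-comm; +-identityˡ; +-identityʳ; *-comm; *-zeroʳ; *-identityʳ; *-distribʳ-+; *-distribˡ-+;
           neg-distrib-+; +-inverseˡ; pos-+; +-commutativeSemigroup)
  open import Data.List using ([]; _∷_; map; upTo; _++_; [_]; foldr)
  open import Data.List.Properties using (map-++; upTo-∷ʳ; map-applyUpTo; map-∘)
  open import Relation.Binary.PropositionalEquality hiding ([_])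
  open import Relation.Nullary using (yes; no)
  open import Data.Sum using (inj₁; inj₂)
  open import Relation.Nullary.Decidable using (dec-true; dec-false)
  open import Function using (_∘_; id)
  open import Algebra.Properties.CommutativeSemigroup +-commutativeSemigroup using (interchange)
  open Partitions
    using (countPartitions; countPartitions-cong; oneDoubledPart; distinctCount; oneDoubledCount; distinctCount-suc;
           oneDoubledCount-suc; distinctCount-stable; oneDoubledCount-bound0; Q≡countPartitions)

  open Shift (+ 0)

  shift-+ : ∀ a n F G → shift a (λ m → F m + G m) n ≡ shift a F n + shift a G n
  shift-+ = shift-distrib _+_ refl

  shiftℕ : ℕ → (ℕ → ℕ) → ℕ → ℕ
  shiftℕ = Shift.shift 0

  pos-shift : ∀ a n F → + shiftℕ a F n ≡ shift a (+_ ∘ F) n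
  pos-shift a n F with a ≤ᵇ n
  ... | true = refl
  ... | false = refl

  sumBelowℤ : ℕ → (ℕ → ℤ) → ℤ
  sumBelowℤ k f = sumℤ (map f (upTo k))

  sumℤ-++ : ∀ xs ys → sumℤ (xs ++ ys) ≡ sumℤ xs + sumℤ ys
  sumℤ-++ [] ys = sym (+-identityˡ _)
  sumℤ-++ (x ∷ xs) ys = trans (cong (_+_ x) (sumℤ-++ xs ys)) (sym (+-assoc x _ _))

  sumBelowℤ-suc : ∀ k f → sumBelowℤ (suc k) f ≡ sumBelowℤ k f + f k
  sumBelowℤ-suc k f = begin
    sumℤ (map f (upTo (suc k)))       ≡⟨ cong (sumℤ ∘ map f) (upTo-∷ʳ k) ⟨
    sumℤ (map f (upTo k ++ [ k ]))    ≡⟨ cong sumℤ (map-++ f (upTo k) [ k ]) ⟩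
    sumℤ (map f (upTo k) ++ [ f k ])  ≡⟨ sumℤ-++ (map f (upTo k)) [ f k ] ⟩
    sumBelowℤ k f + (f k + + 0)       ≡⟨ cong (_+_ (sumBelowℤ k f)) (+-identityʳ (f k)) ⟩
    sumBelowℤ k f + f k               ∎
    where open ≡-Reasoning

  sumBelowℤ-head : ∀ k f → sumBelowℤ (suc k) f ≡ f 0 + sumBelowℤ k (f ∘ suc)
  sumBelowℤ-head k f = cong (λ xs → f 0 + sumℤ xs) (trans (map-applyUpTo suc f k) (sym (map-applyUpTo id (f ∘ suc) k)))

  sumBelowℤ-cong : ∀ k {f g} → (∀ {i} → i < k → f i ≡ g i) → sumBelowℤ k f ≡ sumBelowℤ k g
  sumBelowℤ-cong zero _ = refl
  sumBelowℤ-cong (suc k) {f} {g} f≗g =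
    trans (sumBelowℤ-suc k f) (trans (cong₂ _+_ (sumBelowℤ-cong k (f≗g ∘ ℕₚ.m<n⇒m<1+n)) (f≗g ℕₚ.≤-refl)) (sym (sumBelowℤ-suc k g)))

  sumBelowℤ-zero : ∀ k {f} → (∀ {i} → i < k → f i ≡ + 0) → sumBelowℤ k f ≡ + 0
  sumBelowℤ-zero zero _ = refl
  sumBelowℤ-zero (suc k) {f} f≡0 =
    trans (sumBelowℤ-suc k f) (cong₂ _+_ (sumBelowℤ-zero k (f≡0 ∘ ℕₚ.m<n⇒m<1+n)) (f≡0 ℕₚ.≤-refl))

  sumBelowℤ-+ : ∀ k f g → sumBelowℤ k (λ i → f i + g i) ≡ sumBelowℤ k f + sumBelowℤ k g
  sumBelowℤ-+ zero f g = refl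
  sumBelowℤ-+ (suc k) f g = begin
    sumBelowℤ (suc k) (λ i → f i + g i)                  ≡⟨ sumBelowℤ-suc k _ ⟩
    sumBelowℤ k (λ i → f i + g i) + (f k + g k)          ≡⟨ cong (_+ (f k + g k)) (sumBelowℤ-+ k f g) ⟩
    sumBelowℤ k f + sumBelowℤ k g + (f k + g k)          ≡⟨ interchange (sumBelowℤ k f) (sumBelowℤ k g) (f k) (g k) ⟩
    sumBelowℤ k f + f k + (sumBelowℤ k g + g k)          ≡⟨ cong₂ _+_ (sumBelowℤ-suc k f) (sumBelowℤ-suc k g) ⟨
    sumBelowℤ (suc k) f + sumBelowℤ (suc k) g            ∎
    where open ≡-Reasoning

  sumBelowℤ-neg : ∀ k f → sumBelowℤ k (λ i → - f i) ≡ - sumBelowℤ k f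
  sumBelowℤ-neg zero f = refl
  sumBelowℤ-neg (suc k) f = begin
    sumBelowℤ (suc k) (λ i → - f i)      ≡⟨ sumBelowℤ-suc k _ ⟩
    sumBelowℤ k (λ i → - f i) + - f k    ≡⟨ cong (_+ - f k) (sumBelowℤ-neg k f) ⟩
    - sumBelowℤ k f + - f k              ≡⟨ neg-distrib-+ (sumBelowℤ k f) (f k) ⟨
    - (sumBelowℤ k f + f k)              ≡⟨ cong -_ (sumBelowℤ-suc k f) ⟨
    - sumBelowℤ (suc k) f                ∎
    where open ≡-Reasoning

  sumBelowℤ-stable : ∀ f {k c} → k ≤ c → (∀ {i} → k ≤ i → i < c → f i ≡ + 0) → sumBelowℤ c f ≡ sumBelowℤ k f
  sumBelowℤ-stable f {k} k≤c f≡0 with ℕₚ.m≤n⇒m<n∨m≡n k≤c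
  ... | inj₂ refl = refl
  ... | inj₁ (s≤s {n = c} k≤c) =
    trans (sumBelowℤ-suc c f)
          (trans (cong₂ _+_ (sumBelowℤ-stable f k≤c (λ k≤i i<c → f≡0 k≤i (ℕₚ.m<n⇒m<1+n i<c))) (f≡0 k≤c ℕₚ.≤-refl))
                 (+-identityʳ _))

  sumBelowℤ-reverse : ∀ n f → sumBelowℤ (suc n) f ≡ sumBelowℤ (suc n) (λ i → f (n ∸ i))
  sumBelowℤ-reverse zero f = refl
  sumBelowℤ-reverse (suc n) f = begin
    sumBelowℤ (suc (suc n)) f
      ≡⟨ sumBelowℤ-head (suc n) f ⟩
    f 0 + sumBelowℤ (suc n) (f ∘ suc)
      ≡⟨ cong (_+_ (f 0)) (sumBelowℤ-reverse n (f ∘ suc)) ⟩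
    f 0 + sumBelowℤ (suc n) (λ i → f (suc (n ∸ i)))
      ≡⟨ +-comm (f 0) _ ⟩
    sumBelowℤ (suc n) (λ i → f (suc (n ∸ i))) + f 0
      ≡⟨ cong₂ _+_ (sumBelowℤ-cong (suc n) (λ i<1+n → cong f (sym (ℕₚ.+-∸-assoc 1 (ℕₚ.≤-pred i<1+n)))))
                   (cong f (sym (ℕₚ.n∸n≡0 (suc n)))) ⟩
    sumBelowℤ (suc n) (λ i → f (suc n ∸ i)) + f (suc n ∸ suc n)
      ≡⟨ sumBelowℤ-suc (suc n) (λ i → f (suc n ∸ i)) ⟨
    sumBelowℤ (suc (suc n)) (λ i → f (suc n ∸ i)) ∎
    where open ≡-Reasoning

  ⊛-comm : ∀ f g n → (f ⊛ g) n ≡ (g ⊛ f) n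
  ⊛-comm f g n = trans (sumBelowℤ-reverse n (λ i → f i * g (n ∸ i)))
                       (sumBelowℤ-cong (suc n) λ {i} i≤n → trans (cong (f (n ∸ i) *_) (cong g (ℕₚ.m∸[m∸n]≡n (ℕₚ.≤-pred i≤n))))
                                                                 (*-comm (f (n ∸ i)) (g i)))

  ⊛-congˡ : ∀ {f f'} g n → (∀ {i} → i ≤ n → f i ≡ f' i) → (f ⊛ g) n ≡ (f' ⊛ g) n
  ⊛-congˡ g n f≗f' = sumBelowℤ-cong (suc n) λ {i} i<1+n → cong (_* g (n ∸ i)) (f≗f' (ℕₚ.≤-pred i<1+n))

  ⊛-congʳ : ∀ f {g g'} n → (∀ {i} → i ≤ n → g i ≡ g' i) → (f ⊛ g) n ≡ (f ⊛ g') n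
  ⊛-congʳ f n g≗g' = sumBelowℤ-cong (suc n) λ {i} _ → cong (f i *_) (g≗g' (ℕₚ.m∸n≤m n i))

  ⊛-distribˡ : ∀ f g h n → ((λ i → f i + g i) ⊛ h) n ≡ (f ⊛ h) n + (g ⊛ h) n
  ⊛-distribˡ f g h n = trans (sumBelowℤ-cong (suc n) λ {i} _ → *-distribʳ-+ (h (n ∸ i)) (f i) (g i))
                             (sumBelowℤ-+ (suc n) (λ i → f i * h (n ∸ i)) (λ i → g i * h (n ∸ i)))

  ⊛-distribʳ : ∀ f g h n → (f ⊛ (λ i → g i + h i)) n ≡ (f ⊛ g) n + (f ⊛ h) n
  ⊛-distribʳ f g h n = trans (sumBelowℤ-cong (suc n) λ {i} _ → *-distribˡ-+ (f i) (g (n ∸ i)) (h (n ∸ i)))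
                             (sumBelowℤ-+ (suc n) (λ i → f i * g (n ∸ i)) (λ i → f i * h (n ∸ i)))

  ⊛-identityʳ : ∀ f n → (f ⊛ one) n ≡ f n
  ⊛-identityʳ f n = begin
    (f ⊛ one) n                                        ≡⟨ sumBelowℤ-suc n (λ i → f i * one (n ∸ i)) ⟩
    sumBelowℤ n (λ i → f i * one (n ∸ i)) + f n * one (n ∸ n)
                                                       ≡⟨ cong₂ _+_ (sumBelowℤ-zero n λ {i} i<n → one-pos (f i) (ℕₚ.m<n⇒0<n∸m i<n))
                                                                    (cong (λ k → f n * one k) (ℕₚ.n∸n≡0 n)) ⟩
    + 0 + f n * + 1                                    ≡⟨ trans (+-identityˡ _) (*-identityʳ (f n)) ⟩
    f n                                                ∎
    where
    open ≡-Reasoning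
    one-pos : ∀ x {k} → 0 < k → x * one k ≡ + 0
    one-pos x (s≤s _) = *-zeroʳ x

  ⊛-shiftʳ : ∀ a f g n → (f ⊛ shift a g) n ≡ shift a (f ⊛ g) n
  ⊛-shiftʳ a f g n with a ≤? n
  ... | no a≰n = trans (sumBelowℤ-zero (suc n) λ {i} _ → vanish (ℕₚ.≤-<-trans (ℕₚ.m∸n≤m n i) (ℕₚ.≰⇒> a≰n)))
                       (sym (shift-> (f ⊛ g) (ℕₚ.≰⇒> a≰n)))
    where
    vanish : ∀ {i} → n ∸ i < a → f i * shift a g (n ∸ i) ≡ + 0
    vanish {i} n∸i<a = trans (cong (f i *_) (shift-> g n∸i<a)) (*-zeroʳ (f i))
  ... | yes a≤n = begin
    sumBelowℤ (suc n) (λ i → f i * shift a g (n ∸ i))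
      ≡⟨ sumBelowℤ-stable _ (s≤s (ℕₚ.m∸n≤m n a)) (λ n∸a<i i<1+n → vanish (too-far n∸a<i (ℕₚ.≤-pred i<1+n))) ⟩
    sumBelowℤ (suc (n ∸ a)) (λ i → f i * shift a g (n ∸ i))
      ≡⟨ sumBelowℤ-cong (suc (n ∸ a)) (λ {i} i≤n∸a → cong (f i *_) (trans (shift-≤ g (a≤n∸i (ℕₚ.≤-pred i≤n∸a)))
                                                                          (cong g (∸-swap n i a)))) ⟩
    (f ⊛ g) (n ∸ a)
      ≡⟨ shift-≤ (f ⊛ g) a≤n ⟨
    shift a (f ⊛ g) n ∎
    where
    open ≡-Reasoning
    vanish : ∀ {i} → n ∸ i < a → f i * shift a g (n ∸ i) ≡ + 0
    vanish {i} n∸i<a = trans (cong (f i *_) (shift-> g n∸i<a)) (*-zeroʳ (f i))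
    a≤n∸i : ∀ {i} → i ≤ n ∸ a → a ≤ n ∸ i
    a≤n∸i {i} i≤n∸a = ℕₚ.m+n≤o⇒m≤o∸n a (subst (ℕ._≤ n) (ℕₚ.+-comm i a) (ℕₚ.m≤o∸n⇒m+n≤o i a≤n i≤n∸a))
    too-far : ∀ {i} → n ∸ a < i → i ≤ n → n ∸ i < a
    too-far {i} n∸a<i i≤n = ℕₚ.≰⇒> λ a≤n∸i → ℕₚ.<⇒≱ n∸a<i
      (ℕₚ.m+n≤o⇒m≤o∸n i (subst (ℕ._≤ n) (ℕₚ.+-comm a i) (ℕₚ.m≤o∸n⇒m+n≤o a i≤n a≤n∸i)))
    ∸-swap : ∀ n i a → n ∸ i ∸ a ≡ n ∸ a ∸ i
    ∸-swap n i a = trans (ℕₚ.∸-+-assoc n i a) (trans (cong (n ∸_) (ℕₚ.+-comm i a)) (sym (ℕₚ.∸-+-assoc n a i)))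

  ⊛-shiftˡ : ∀ a f g n → (shift a f ⊛ g) n ≡ shift a (f ⊛ g) n
  ⊛-shiftˡ a f g n = trans (⊛-comm (shift a f) g n) (trans (⊛-shiftʳ a g f n) (shift-cong a n λ m _ → ⊛-comm g f m))

  qpow≗shift-one : ∀ a → qpow a ≗ shift a one
  qpow≗shift-one a i with a ≤? i
  ... | no a≰i = trans (cong (λ b → if b then + 1 else + 0) (dec-false (i ≟ a) λ { refl → a≰i ℕₚ.≤-refl }))
                       (sym (shift-> one (ℕₚ.≰⇒> a≰i)))
  ... | yes a≤i with i ≟ a
  ...   | yes refl = trans (cong (λ b → if b then + 1 else + 0) (dec-true (i ≟ i) refl))
                           (sym (trans (shift-≤ one a≤i) (cong one (ℕₚ.n∸n≡0 i))))
  ...   | no i≢a = trans (cong (λ b → if b then + 1 else + 0) (dec-false (i ≟ a) i≢a))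
                         (sym (trans (shift-≤ one a≤i)
                                     (cong (λ b → if b then + 1 else + 0) (dec-false (i ∸ a ≟ 0) (ℕₚ.m>n⇒m∸n≢0 a<i)))))
    where
    a<i : a < i
    a<i = ℕₚ.≤∧≢⇒< a≤i (i≢a ∘ sym)

  ⊛-qpowʳ : ∀ a f n → (f ⊛ qpow a) n ≡ shift a f n
  ⊛-qpowʳ a f n = trans (⊛-congʳ f n λ {i} _ → qpow≗shift-one a i) (trans (⊛-shiftʳ a f one n) (shift-cong a n λ m _ → ⊛-identityʳ f m))

  ⊛-qpowˡ : ∀ a f n → (qpow a ⊛ f) n ≡ shift a f n
  ⊛-qpowˡ a f n = trans (⊛-comm (qpow a) f n) (⊛-qpowʳ a f n)

  mulOnePlus : ℕ → Series → Series
  mulOnePlus a s m = s m + shift a s m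

  onePlus⊛ : ∀ a s n → ((one ⊕ qpow a) ⊛ s) n ≡ mulOnePlus a s n
  onePlus⊛ a s n = trans (⊛-distribˡ one (qpow a) s n)
                         (cong₂ _+_ (trans (⊛-comm one s n) (⊛-identityʳ s n)) (⊛-qpowˡ a s n))

  ⊛-mulOnePlusˡ : ∀ a f g n → (mulOnePlus a f ⊛ g) n ≡ mulOnePlus a (f ⊛ g) n
  ⊛-mulOnePlusˡ a f g n = trans (⊛-distribˡ f (shift a f) g n) (cong (_+_ ((f ⊛ g) n)) (⊛-shiftˡ a f g n))

  ⊛-mulOnePlusʳ : ∀ a f g n → (f ⊛ mulOnePlus a g) n ≡ mulOnePlus a (f ⊛ g) n
  ⊛-mulOnePlusʳ a f g n = trans (⊛-distribʳ f g (shift a g) n) (cong (_+_ ((f ⊛ g) n)) (⊛-shiftʳ a f g n))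

  mulOnePlus-cong : ∀ a {s s'} → s ≗ s' → mulOnePlus a s ≗ mulOnePlus a s'
  mulOnePlus-cong a s≗s' m = cong₂ _+_ (s≗s' m) (shift-cong a m λ x _ → s≗s' x)

  mulOnePlus-comm : ∀ a c s → mulOnePlus a (mulOnePlus c s) ≗ mulOnePlus c (mulOnePlus a s)
  mulOnePlus-comm a c s m = begin
    (s m + shift c s m) + shift a (λ x → s x + shift c s x) m
      ≡⟨ cong (_+_ (s m + shift c s m)) (trans (shift-+ a m s (shift c s)) (cong (_+_ (shift a s m)) (shift-shift a c m s))) ⟩
    (s m + shift c s m) + (shift a s m + shift (a ℕ.+ c) s m)
      ≡⟨ cong (λ e → (s m + shift c s m) + (shift a s m + shift e s m)) (ℕₚ.+-comm a c) ⟩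
    (s m + shift c s m) + (shift a s m + shift (c ℕ.+ a) s m)
      ≡⟨ interchange (s m) (shift c s m) (shift a s m) (shift (c ℕ.+ a) s m) ⟩
    (s m + shift a s m) + (shift c s m + shift (c ℕ.+ a) s m)
      ≡⟨ cong (_+_ (s m + shift a s m)) (trans (shift-+ c m s (shift a s)) (cong (_+_ (shift c s m)) (shift-shift c a m s))) ⟨
    (s m + shift a s m) + shift c (λ x → s x + shift a s x) m ∎
    where open ≡-Reasoning

  foldr-onePlus⊛ : ∀ xs → foldr (λ i s → (one ⊕ qpow i) ⊛ s) one xs ≗ foldr mulOnePlus one xs
  foldr-onePlus⊛ [] m = refl
  foldr-onePlus⊛ (x ∷ xs) m =
    trans (onePlus⊛ x (foldr (λ i s → (one ⊕ qpow i) ⊛ s) one xs) m) (mulOnePlus-cong x (foldr-onePlus⊛ xs) m)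

  foldr-mulOnePlus-∷ʳ : ∀ xs a s → foldr mulOnePlus s (xs ++ [ a ]) ≗ mulOnePlus a (foldr mulOnePlus s xs)
  foldr-mulOnePlus-∷ʳ [] a s m = refl
  foldr-mulOnePlus-∷ʳ (x ∷ xs) a s m =
    trans (mulOnePlus-cong x (foldr-mulOnePlus-∷ʳ xs a s) m) (mulOnePlus-comm x a (foldr mulOnePlus s xs) m)

  distinctSeries : ℕ → Series
  distinctSeries b m = + distinctCount (λ _ → true) m b

  distinctSeries-zero : distinctSeries 0 ≗ one
  distinctSeries-zero zero = refl
  distinctSeries-zero (suc m) = refl

  distinctSeries-suc : ∀ b → distinctSeries (suc b) ≗ mulOnePlus (suc b) (distinctSeries b)
  distinctSeries-suc b m =
    trans (cong +_ (distinctCount-suc (λ _ → true) m b))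
          (trans (pos-+ (distinctCount (λ _ → true) m b) _)
                 (cong (_+_ (distinctSeries b m)) (pos-shift (suc b) m (λ x → distinctCount (λ _ → true) x b))))

  finProd≗distinctSeries : ∀ N → finProd N ≗ distinctSeries N
  finProd≗distinctSeries zero m = sym (distinctSeries-zero m)
  finProd≗distinctSeries (suc N) m = begin
    finProd (suc N) m                                       ≡⟨ foldr-onePlus⊛ (map suc (upTo (suc N))) m ⟩
    foldr mulOnePlus one (map suc (upTo (suc N))) m         ≡⟨ cong (λ xs → foldr mulOnePlus one (map suc xs) m) (upTo-∷ʳ N) ⟨
    foldr mulOnePlus one (map suc (upTo N ++ [ N ])) m      ≡⟨ cong (λ xs → foldr mulOnePlus one xs m) (map-++ suc (upTo N) [ N ]) ⟩
    foldr mulOnePlus one (map suc (upTo N) ++ [ suc N ]) m  ≡⟨ foldr-mulOnePlus-∷ʳ (map suc (upTo N)) (suc N) one m ⟩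
    mulOnePlus (suc N) (foldr mulOnePlus one (map suc (upTo N))) m
                                                            ≡⟨ mulOnePlus-cong (suc N) (λ i → trans (sym (foldr-onePlus⊛ (map suc (upTo N)) i))
                                                                                                    (finProd≗distinctSeries N i)) m ⟩
    mulOnePlus (suc N) (distinctSeries N) m                 ≡⟨ distinctSeries-suc N m ⟨
    distinctSeries (suc N) m                                ∎
    where open ≡-Reasoning

  invTerm : ℕ → ℕ → ℕ → ℤ
  invTerm k m j = if k ℕ.* j ≡ᵇ m then sign j else + 0

  invOnePlus-vanish : ∀ k m → (∀ j → k ℕ.* j ≢ m) → invOnePlus k m ≡ + 0
  invOnePlus-vanish k m k*j≢m =
    sumBelowℤ-zero (suc m) λ {j} _ → cong (λ b → if b then sign j else + 0) (dec-false (k ℕ.* j ≟ m) (k*j≢m j))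

  +-≡ᵇ-cancelˡ : ∀ k y x → (k ℕ.+ y ≡ᵇ k ℕ.+ x) ≡ (y ≡ᵇ x)
  +-≡ᵇ-cancelˡ zero y x = refl
  +-≡ᵇ-cancelˡ (suc k) y x = +-≡ᵇ-cancelˡ k y x

  invOnePlus-step : ∀ k x → invOnePlus (suc k) (suc k ℕ.+ x) ≡ - invOnePlus (suc k) x
  invOnePlus-step k x = begin
    sumBelowℤ (suc (K ℕ.+ x)) (invTerm K (K ℕ.+ x))
      ≡⟨ sumBelowℤ-head (K ℕ.+ x) (invTerm K (K ℕ.+ x)) ⟩
    invTerm K (K ℕ.+ x) 0 + sumBelowℤ (K ℕ.+ x) (invTerm K (K ℕ.+ x) ∘ suc)
      ≡⟨ cong₂ _+_ first (sumBelowℤ-cong (K ℕ.+ x) λ {j} _ → later j) ⟩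
    + 0 + sumBelowℤ (K ℕ.+ x) (λ j → - invTerm K x j)
      ≡⟨ +-identityˡ _ ⟩
    sumBelowℤ (K ℕ.+ x) (λ j → - invTerm K x j)
      ≡⟨ sumBelowℤ-neg (K ℕ.+ x) (invTerm K x) ⟩
    - sumBelowℤ (K ℕ.+ x) (invTerm K x)
      ≡⟨ cong -_ (sumBelowℤ-stable (invTerm K x) (s≤s (ℕₚ.m≤n+m x k)) beyond) ⟩
    - sumBelowℤ (suc x) (invTerm K x) ∎
    where
    open ≡-Reasoning
    K : ℕ
    K = suc k
    first : invTerm K (K ℕ.+ x) 0 ≡ + 0
    first = cong (λ z → if z ≡ᵇ K ℕ.+ x then + 1 else + 0) (ℕₚ.*-zeroʳ K)
    later : ∀ j → invTerm K (K ℕ.+ x) (suc j) ≡ - invTerm K x j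
    later j = trans (cong (λ z → if z ≡ᵇ K ℕ.+ x then - sign j else + 0) (ℕₚ.*-suc K j))
                    (trans (cong (λ b → if b then - sign j else + 0) (+-≡ᵇ-cancelˡ K (K ℕ.* j) x)) (if-neg (K ℕ.* j ≡ᵇ x)))
      where
      if-neg : ∀ b → (if b then - sign j else + 0) ≡ - (if b then sign j else + 0)
      if-neg true = refl
      if-neg false = refl
    beyond : ∀ {j} → suc x ≤ j → j < K ℕ.+ x → invTerm K x j ≡ + 0
    beyond {j} x<j _ =
      cong (λ b → if b then sign j else + 0) (dec-false (K ℕ.* j ≟ x) (ℕₚ.>⇒≢ (ℕₚ.<-≤-trans x<j (ℕₚ.m≤n*m j K))))

  mulOnePlus-invOnePlus : ∀ k → mulOnePlus (suc k) (invOnePlus (suc k)) ≗ one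
  mulOnePlus-invOnePlus k zero = cong (λ z → (if z ≡ᵇ 0 then + 1 else + 0) + + 0 + + 0) (ℕₚ.*-zeroʳ k)
  mulOnePlus-invOnePlus k (suc m) with suc k ≤? suc m
  ... | no K≰m = cong₂ _+_ (invOnePlus-vanish (suc k) (suc m) too-big) (shift-> (invOnePlus (suc k)) (ℕₚ.≰⇒> K≰m))
    where
    too-big : ∀ j → suc k ℕ.* j ≢ suc m
    too-big zero eq = ℕₚ.0≢1+n (trans (sym (ℕₚ.*-zeroʳ k)) eq)
    too-big (suc j) eq = K≰m (subst (suc k ℕ.≤_) eq (ℕₚ.m≤m*n (suc k) (suc j)))
  ... | yes K≤m = begin
    invOnePlus K (suc m) + shift K (invOnePlus K) (suc m)  ≡⟨ cong₂ _+_ (cong (invOnePlus K) (sym K+x≡m)) (shift-≤ (invOnePlus K) K≤m) ⟩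
    invOnePlus K (K ℕ.+ x) + invOnePlus K x                ≡⟨ cong (_+ invOnePlus K x) (invOnePlus-step k x) ⟩
    - invOnePlus K x + invOnePlus K x                      ≡⟨ +-inverseˡ (invOnePlus K x) ⟩
    + 0                                                    ∎
    where
    open ≡-Reasoning
    K x : ℕ
    K = suc k
    x = suc m ∸ K
    K+x≡m : K ℕ.+ x ≡ suc m
    K+x≡m = ℕₚ.m+[n∸m]≡n K≤m

  lambertTerm : ℕ → Series
  lambertTerm k = qpow (2 ℕ.* k) ⊛ invOnePlus k

  mulOnePlus-lambertTerm : ∀ k → mulOnePlus (suc k) (lambertTerm (suc k)) ≗ qpow (2 ℕ.* suc k)
  mulOnePlus-lambertTerm k j = begin
    mulOnePlus (suc k) (q2k ⊛ invOnePlus (suc k)) j   ≡⟨ ⊛-mulOnePlusʳ (suc k) q2k (invOnePlus (suc k)) j ⟨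
    (q2k ⊛ mulOnePlus (suc k) (invOnePlus (suc k))) j ≡⟨ ⊛-congʳ q2k j (λ {i} _ → mulOnePlus-invOnePlus k i) ⟩
    (q2k ⊛ one) j                                     ≡⟨ ⊛-identityʳ q2k j ⟩
    q2k j                                             ∎
    where
    open ≡-Reasoning
    q2k : Series
    q2k = qpow (2 ℕ.* suc k)

  lambertPartial : ℕ → Series
  lambertPartial b j = sumBelowℤ b (λ k → lambertTerm (suc k) j)

  lambertSum≡lambertPartial : ∀ j → lambertSum j ≡ lambertPartial j j
  lambertSum≡lambertPartial j = cong sumℤ (sym (map-∘ (upTo j)))

  lambertPartial-stable : ∀ {b j} → j ≤ b → lambertPartial b j ≡ lambertPartial j j
  lambertPartial-stable {b} {j} j≤b = sumBelowℤ-stable _ j≤b λ {k} j≤k _ →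
    trans (⊛-qpowˡ (2 ℕ.* suc k) (invOnePlus (suc k)) j)
          (shift-> (invOnePlus (suc k)) (ℕₚ.<-≤-trans (s≤s j≤k) (ℕₚ.m≤m+n (suc k) _)))

  oneDoubledSeries : ℕ → Series
  oneDoubledSeries b m = + oneDoubledCount (λ _ → true) m b

  oneDoubledSeries-suc : ∀ b m → oneDoubledSeries (suc b) m ≡
                         oneDoubledSeries b m + shift (suc b) (λ x → oneDoubledSeries b x + shift (suc b) (distinctSeries b) x) m
  oneDoubledSeries-suc b m = begin
    + O (suc b) m
      ≡⟨ cong +_ (oneDoubledCount-suc (λ _ → true) m b) ⟩
    + (O b m ℕ.+ shiftℕ (suc b) tail m)
      ≡⟨ pos-+ (O b m) _ ⟩
    + O b m + + shiftℕ (suc b) tail m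
      ≡⟨ cong (_+_ (+ O b m)) (pos-shift (suc b) m tail) ⟩
    + O b m + shift (suc b) (λ x → + tail x) m
      ≡⟨ cong (_+_ (+ O b m)) (shift-cong (suc b) m λ x _ → trans (pos-+ (O b x) _) (cong (_+_ (+ O b x)) (pos-shift (suc b) x (D b)))) ⟩
    + O b m + shift (suc b) (λ x → + O b x + shift (suc b) (distinctSeries b) x) m ∎
    where
    open ≡-Reasoning
    O D : ℕ → ℕ → ℕ
    O b m = oneDoubledCount (λ _ → true) m b
    D b m = distinctCount (λ _ → true) m b
    tail : ℕ → ℕ
    tail x = O b x ℕ.+ shiftℕ (suc b) (D b) x

  distinctSeries⊛lambertPartial : ∀ b → (distinctSeries b ⊛ lambertPartial b) ≗ oneDoubledSeries b
  distinctSeries⊛lambertPartial zero m =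
    trans (sumBelowℤ-zero (suc m) λ {i} _ → *-zeroʳ (distinctSeries 0 i)) (cong +_ (sym (oneDoubledCount-bound0 _ m)))
  distinctSeries⊛lambertPartial (suc b) m = begin
    (E (suc b) ⊛ Λ (suc b)) m
      ≡⟨ ⊛-congʳ (E (suc b)) m (λ {j} _ → sumBelowℤ-suc b (λ k → lambertTerm (suc k) j)) ⟩
    (E (suc b) ⊛ (λ j → Λ b j + G j)) m
      ≡⟨ ⊛-distribʳ (E (suc b)) (Λ b) G m ⟩
    (E (suc b) ⊛ Λ b) m + (E (suc b) ⊛ G) m
      ≡⟨ cong₂ _+_ (⊛-congˡ (Λ b) m λ {i} _ → distinctSeries-suc b i) (⊛-congˡ G m λ {i} _ → distinctSeries-suc b i) ⟩
    (mulOnePlus (suc b) (E b) ⊛ Λ b) m + (mulOnePlus (suc b) (E b) ⊛ G) m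
      ≡⟨ cong₂ _+_ (⊛-mulOnePlusˡ (suc b) (E b) (Λ b) m)
                   (trans (⊛-mulOnePlusˡ (suc b) (E b) G m) (sym (⊛-mulOnePlusʳ (suc b) (E b) G m))) ⟩
    mulOnePlus (suc b) (E b ⊛ Λ b) m + (E b ⊛ mulOnePlus (suc b) G) m
      ≡⟨ cong₂ _+_ (mulOnePlus-cong (suc b) (distinctSeries⊛lambertPartial b) m)
                   (⊛-congʳ (E b) m (λ {j} _ → mulOnePlus-lambertTerm b j)) ⟩
    mulOnePlus (suc b) (F b) m + (E b ⊛ qpow (2 ℕ.* suc b)) m
      ≡⟨ cong (_+_ (mulOnePlus (suc b) (F b) m)) (⊛-qpowʳ (2 ℕ.* suc b) (E b) m) ⟩
    (F b m + shift (suc b) (F b) m) + shift (2 ℕ.* suc b) (E b) m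
      ≡⟨ +-assoc (F b m) (shift (suc b) (F b) m) (shift (2 ℕ.* suc b) (E b) m) ⟩
    F b m + (shift (suc b) (F b) m + shift (2 ℕ.* suc b) (E b) m)
      ≡⟨ cong (λ e → F b m + (shift (suc b) (F b) m + shift (suc b ℕ.+ e) (E b) m)) (ℕₚ.+-identityʳ (suc b)) ⟩
    F b m + (shift (suc b) (F b) m + shift (suc b ℕ.+ suc b) (E b) m)
      ≡⟨ cong (λ e → F b m + (shift (suc b) (F b) m + e)) (shift-shift (suc b) (suc b) m (E b)) ⟨
    F b m + (shift (suc b) (F b) m + shift (suc b) (shift (suc b) (E b)) m)
      ≡⟨ cong (_+_ (F b m)) (shift-+ (suc b) m (F b) (shift (suc b) (E b))) ⟨
    F b m + shift (suc b) (λ x → F b x + shift (suc b) (E b) x) m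
      ≡⟨ oneDoubledSeries-suc b m ⟨
    F (suc b) m ∎
    where
    open ≡-Reasoning
    E F Λ : ℕ → Series
    E = distinctSeries
    F = oneDoubledSeries
    Λ = lambertPartial
    G : Series
    G = lambertTerm (suc b)

  rhs≡Q : ∀ n → rhs n ≡ + Q n
  rhs≡Q n = begin
    (negQPoch ⊛ lambertSum) n
      ≡⟨ ⊛-congˡ lambertSum n (λ {i} i≤n → trans (finProd≗distinctSeries i i) (cong +_ (sym (distinctCount-stable _ i≤n)))) ⟩
    (distinctSeries n ⊛ lambertSum) n
      ≡⟨ ⊛-congʳ (distinctSeries n) n (λ {j} j≤n → trans (lambertSum≡lambertPartial j) (sym (lambertPartial-stable j≤n))) ⟩
    (distinctSeries n ⊛ lambertPartial n) n
      ≡⟨ distinctSeries⊛lambertPartial n n ⟩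
    + oneDoubledCount (λ _ → true) n n
      ≡⟨ cong +_ (countPartitions-cong _ _ n n (λ {π} _ → ∧-identityʳ (oneDoubledPart π))) ⟩
    + countPartitions oneDoubledPart n n
      ≡⟨ cong +_ (Q≡countPartitions n) ⟨
    + Q n ∎
    where open ≡-Reasoning


open import Data.Integer using (+_)

corollary2p4 : ((n : ℕ) → + P1 n ≡ rhs n) × ((n : ℕ) → P1 n ≡ Q n)
corollary2p4 = (λ n → trans (cong +_ (P1≡Q n)) (sym (rhs≡Q n))) , P1≡Q
  where
  open Partitions using (P1≡Q)
  open Series using (rhs≡Q)
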